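{- Let $(X_i,Y_i,c_i)$, $i\in[k]$, be a simple instance on $[n]$ and $\delta\in\mathbb{R}_{\ge0}^k$. If there exist nonnegative values $\sigma,\mu$ such that $(\delta,\sigma,\mu)$ is feasible for the linear program $D$, then for every $t\in[n]$ there is a flow of value $1$ from $\emptyset$ to $\{t\}$ in the capacitated digraph $G_\delta$ (i.e., $\delta$ is feasible for $D'_S$).
   Context: A difference constraint is $(X,Y,c)$ with $X\subsetneq Y\subseteq[n]$; simple means $|X_i|\le 1$ for all $i$. For sets, $X\perp Y$ means $X\not\subseteq Y$ and $Y\not\subseteq X$. The LP $D$ has nonnegative variables $\delta_i$ ($i\in[k]$), $\sigma_{\{I,J\}}$ for each unordered pair of subsets $I\perp J$ of $[n]$ (written $\sigma_{I,J}=\sigma_{J,I}$), and $\mu_{X,Y}$ for $X\subsetneq Y\subseteq[n]$. For $Z\subseteq[n]$ let $\mathrm{excess}(Z)=\sum_{i:Z=Y_i}\delta_i-\sum_{i:Z=X_i}\delta_i+\sum_{\{I,J\}:I\perp J,\ I\cap J=Z}\sigma_{I,J}+\sum_{\{I,J\}:I\perp J,\ I\cup J=Z}\sigma_{I,J}-\sum_{J:J\perp Z}\sigma_{Z,J}-\sum_{X\subsetneq Z}\mu_{X,Z}+\sum_{Y\supsetneq Z}\mu_{Z,Y}$. Feasibility for $D$ means $\mathrm{excess}([n])\ge1$, $\mathrm{excess}(\emptyset)\ge-1$, and $\mathrm{excess}(Z)\ge0$ for all $Z\ne\emptyset,[n]$. The digraph $G_\delta$ has vertices $\emptyset$, $\{t\}$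 ($t\in[n]$), $Y_i$ ($i\in[k]$); an arc $X_i\to Y_i$ of capacity $\delta_i$ for each $i$; and an arc $Y\to X$ of infinite capacity for each pair of vertices $X\subsetneq Y$ with $|X|\le1$. -}

module Defs where

open import Level using (0ℓ)
open import Data.Nat using (ℕ; zero; suc; _≤_; _≤?_)
open import Data.Bool using (Bool; true; false; _∧_; _∨_; not; if_then_else_)
open import Data.Bool.Properties using () renaming (_≟_ to _≟B_)
open import Data.Fin using (Fin)
open import Data.Fin.Subset using (Subset; _⊆_; _⊂_; _∩_; _∪_; ∣_∣) renaming (⊥ to ∅; ⊤ to full)
open import Data.Fin.Subset.Properties using (_⊆?_; _⊂?_)
open import Data.Vec using (Vec; []; _∷_)
open import Data.Vec.Properties using (≡-dec)
open import Data.List using (List; []; _∷_; _++_; map; foldr; allFin)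
open import Data.Bool.ListAction using (any)
open import Data.Product using (_×_; _,_; proj₁; proj₂)
open import Relation.Nullary using (¬_; does)
open import Relation.Binary.PropositionalEquality using (_≡_)
open import Relation.Binary.Structures using (IsTotalOrder)
open import Algebra.Structures using (IsCommutativeRing)

-- Ordered fields (the paper works over ℝ; ℝ is an instance, so stating
-- the lemma for every ordered field is at least as strong).

record OrderedField : Set₁ where
  infixl 6 _+_
  infixl 7 _*_
  infix  4 _≤ᶠ_
  field
    Carrier : Set
    _+_ _*_ : Carrier → Carrier → Carrier
    -_      : Carrier → Carrier
    0# 1#   : Carrier
    _≤ᶠ_    : Carrier → Carrier → Set
    isCommutativeRing : IsCommutativeRing _≡_ _+_ _*_ -_ 0# 1#
    inverse : (x : Carrier) → ¬ (x ≡ 0#) → Carrier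
    inverse-inv : (x : Carrier) (x≢0 : ¬ (x ≡ 0#)) → x * inverse x x≢0 ≡ 1#
    0≢1     : ¬ (0# ≡ 1#)
    isTotalOrder : IsTotalOrder _≡_ _≤ᶠ_
    +-monoˡ : ∀ {x y} z → x ≤ᶠ y → x + z ≤ᶠ y + z
    *-nonneg : ∀ {x y} → 0# ≤ᶠ x → 0# ≤ᶠ y → 0# ≤ᶠ x * y

allSubsets : (n : ℕ) → List (Subset n)
allSubsets zero    = [] ∷ []
allSubsets (suc n) = map (true ∷_) (allSubsets n) ++ map (false ∷_) (allSubsets n)

-- all unordered pairs {a_p, a_q} with p < q of a list (each once when the
-- list has no duplicates)
upairs : {A : Set} → List A → List (A × A)
upairs []       = []
upairs (x ∷ xs) = map (x ,_) xs ++ upairs xs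

module _ {n : ℕ} where

  eqᵇ : Subset n → Subset n → Bool
  eqᵇ X Y = does (≡-dec _≟B_ X Y)

  ⊂ᵇ : Subset n → Subset n → Bool
  ⊂ᵇ X Y = does (X ⊂? Y)

  ⊥ᵇ : Subset n → Subset n → Bool
  ⊥ᵇ X Y = not (does (X ⊆? Y)) ∧ not (does (Y ⊆? X))

  atMostOneᵇ : Subset n → Bool
  atMostOneᵇ X = does (∣ X ∣ ≤? 1)

record SimpleInstance (C : Set) (n k : ℕ) : Set where
  field
    X : Fin k → Subset n
    Y : Fin k → Subset n
    c : Fin k → C
    X⊂Y : ∀ i → X i ⊂ Y i
    simple : ∀ i → ∣ X i ∣ ≤ 1

module _ (F : OrderedField) where
  open OrderedField F

  infixl 6 _-ᶠ_
  _-ᶠ_ : Carrier → Carrier → Carrier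
  x -ᶠ y = x + (- y)

  sumIf : {A : Set} → List A → (A → Bool) → (A → Carrier) → Carrier
  sumIf xs p f = foldr (λ a s → if p a then f a + s else s) 0# xs

  module _ {n k : ℕ} (I : SimpleInstance Carrier n k) where
    open SimpleInstance I

    -- excess(Z) for the variables δ, σ (σ I J, meant for unordered pairs,
    -- symmetry assumed separately) and μ (μ X Y for X ⊊ Y).
    excess : (δ : Fin k → Carrier) (σ μ : Subset n → Subset n → Carrier)
           → Subset n → Carrier
    excess δ σ μ Z =
        sumIf (allFin k) (λ i → eqᵇ Z (Y i)) δ
      -ᶠ sumIf (allFin k) (λ i → eqᵇ Z (X i)) δ
      + sumIf (upairs (allSubsets n))
              (λ p → ⊥ᵇ (proj₁ p) (proj₂ p) ∧ eqᵇ (proj₁ p ∩ proj₂ p) Z)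
              (λ p → σ (proj₁ p) (proj₂ p))
      + sumIf (upairs (allSubsets n))
              (λ p → ⊥ᵇ (proj₁ p) (proj₂ p) ∧ eqᵇ (proj₁ p ∪ proj₂ p) Z)
              (λ p → σ (proj₁ p) (proj₂ p))
      -ᶠ sumIf (allSubsets n) (λ J → ⊥ᵇ J Z) (λ J → σ Z J)
      -ᶠ sumIf (allSubsets n) (λ X' → ⊂ᵇ X' Z) (λ X' → μ X' Z)
      + sumIf (allSubsets n) (λ Y' → ⊂ᵇ Z Y') (λ Y' → μ Z Y')

    FeasibleD : (δ : Fin k → Carrier) (σ μ : Subset n → Subset n → Carrier) → Set
    FeasibleD δ σ μ =
        (∀ i → 0# ≤ᶠ δ i)
      × (∀ I J → 0# ≤ᶠ σ I J)
      × (∀ I J → σ I J ≡ σ J I)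
      × (∀ X' Y' → 0# ≤ᶠ μ X' Y')
      × (1# ≤ᶠ excess δ σ μ full)
      × (- 1# ≤ᶠ excess δ σ μ ∅)
      × (∀ Z → ¬ (Z ≡ ∅) → ¬ (Z ≡ full) → 0# ≤ᶠ excess δ σ μ Z)

    isVertexᵇ : Subset n → Bool
    isVertexᵇ Z = eqᵇ Z ∅ ∨ does (∣ Z ∣ Data.Nat.≟ 1) ∨ any (λ i → eqᵇ Z (Y i)) (allFin k)

    IsVertex : Subset n → Set
    IsVertex Z = isVertexᵇ Z ≡ true

    -- A flow in G_δ: f i on the arc X_i → Y_i (capacity δ_i), and g Y' X'
    -- on the infinite-capacity arc Y' → X' (vertices X' ⊊ Y', |X'| ≤ 1).
    inflow : (f : Fin k → Carrier) (g : Subset n → Subset n → Carrier)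
           → Subset n → Carrier
    inflow f g Z =
        sumIf (allFin k) (λ i → eqᵇ Z (Y i)) f
      + sumIf (allSubsets n) (λ Y' → isVertexᵇ Y' ∧ ⊂ᵇ Z Y' ∧ atMostOneᵇ Z)
              (λ Y' → g Y' Z)

    outflow : (f : Fin k → Carrier) (g : Subset n → Subset n → Carrier)
            → Subset n → Carrier
    outflow f g Z =
        sumIf (allFin k) (λ i → eqᵇ Z (X i)) f
      + sumIf (allSubsets n) (λ X' → isVertexᵇ X' ∧ ⊂ᵇ X' Z ∧ atMostOneᵇ X')
              (λ X' → g Z X')

    IsUnitFlow : (δ : Fin k → Carrier) (T : Subset n)
               → (f : Fin k → Carrier) (g : Subset n → Subset n → Carrier) → Set
    IsUnitFlow δ T f g =
        (∀ i → 0# ≤ᶠ f i)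
      × (∀ i → f i ≤ᶠ δ i)
      × (∀ Y' X' → 0# ≤ᶠ g Y' X')
      × (∀ Z → IsVertex Z → ¬ (Z ≡ ∅) → ¬ (Z ≡ T) → inflow f g Z ≡ outflow f g Z)
      × (outflow f g ∅ -ᶠ inflow f g ∅ ≡ 1#)

-- Fix t and R ⊆ [n] with t ∉ R, and add up the excess inequalities of D over all Z ⊈ R. The δ-terms
-- contribute at most the δ-weight of the constraints with X_i ⊆ R and Y_i ⊈ R; the σ-terms contribute
-- at most 0 since Z ↦ [Z ⊈ R] is submodular, and the μ-terms at most 0 since it is monotone. As
-- excess([n]) ≥ 1, the constraints jumping out of R carry δ-weight at least 1.
-- In G_δ, with each arc X_i → Y_i subdivided and the infinite capacities replaced by 1, a cut that
-- separates ∅ from {t} is either crossed by an infinite arc, or closed under them; then the jumping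
-- constraints of R = {j | {j} in the cut} all cross it. So every such cut has capacity at least 1,
-- and max-flow min-cut yields the flow.

module Submission where

open import Defs
open import Level using (0ℓ)
open import Algebra.Bundles using (CommutativeRing)
import Algebra.Properties.Ring as RingProperties
import Algebra.Solver.CommutativeMonoid as CommutativeMonoidSolver
open import Data.Bool using (Bool; true; false; _∧_; _∨_; not; if_then_else_; T)
open import Data.Bool.ListAction using (any)
open import Data.Bool.Properties using (not-involutive; not-injective; ∧-comm; ∧-zeroʳ; ∨-zeroʳ) renaming (_≟_ to _≟ᵇ_)
open import Data.Empty using (⊥-elim)
open import Data.Fin using (Fin) renaming (zero to fzero; suc to fsuc)
open import Data.Fin.Properties using () renaming (_≟_ to _≟ᶠ_)
open import Data.Fin.Subset using (Subset; _⊆_; _⊂_; _∩_; _∪_; ⁅_⁆; ∣_∣) renaming (⊥ to ∅; ⊤ to full; _∈_ to _∈ₛ_; _∉_ to _∉ₛ_)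
open import Data.Fin.Subset.Properties using (_⊆?_; _⊂?_; _∈?_; ⊆-refl; ⊆-trans; ⊆-antisym; ⊥⊆; ∈⊤; ∉⊥; p∩q⊆p; p∩q⊆q; x∈p∪q⁻; p⊂q⇒p⊆q; x∈⁅x⁆; x∈⁅y⁆⇒x≡y; ∣⁅x⁆∣≡1)
open import Data.List using (List; []; _∷_; _++_; map; filter; allFin; cartesianProduct)
import Data.List.Extrema as Extrema
open import Data.List.Membership.Propositional using (_∈_; find; lose)
open import Data.List.Membership.Propositional.Properties using (∈-++⁺ˡ; ∈-++⁺ʳ; ∈-map⁺; ∈-map⁻; ∈-filter⁺; ∈-filter⁻; ∈-allFin; ∈-cartesianProduct⁺)
open import Data.List.Relation.Unary.All using (All; []; _∷_)
open import Data.List.Relation.Unary.AllPairs using ([]; _∷_)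
open import Data.List.Relation.Unary.Any using (here; there; any?)
open import Data.List.Relation.Unary.Unique.Propositional using (Unique)
open import Data.List.Relation.Unary.Unique.Propositional.Properties using (++⁺; map⁺; allFin⁺)
open import Data.Nat using (ℕ; zero; suc; s≤s; _≤ᵇ_) renaming (_≤_ to _≤ℕ_; _≟_ to _≟ℕ_)
open import Data.Nat.Properties using (≤ᵇ⇒≤)
open import Data.Product using (Σ; _×_; _,_; proj₁; proj₂)
open import Data.Sum using (_⊎_; inj₁; inj₂)
open import Data.Sum.Properties using (inj₁-injective; inj₂-injective) renaming (≡-dec to ≡-dec-⊎)
open import Data.Unit using (tt)
open import Data.Vec using ([]; _∷_; tabulate)
open import Data.Vec.Properties using (≡-dec; ∷-injectiveʳ; lookup∘tabulate; lookup⇒[]=; []=⇒lookup)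
open import Function using (_∘_; case_of_)
open import Relation.Binary.Bundles using (Poset; TotalOrder)
open import Relation.Binary.Definitions using (DecidableEquality)
open import Relation.Binary.PropositionalEquality hiding ([_]; poset)
import Relation.Binary.Reasoning.PartialOrder as PartialOrderReasoning
open import Relation.Binary.Structures using (IsTotalOrder)
open import Relation.Nullary using (¬_; yes; no; does)
open import Relation.Nullary.Decidable using (_×-dec_)
open import Relation.Unary using (Decidable)

∧-true⁻ : ∀ {p q} → (p ∧ q) ≡ true → (p ≡ true) × (q ≡ true)
∧-true⁻ {true} q≡true = refl , q≡true

module Arithmetic (F : OrderedField) where
  open OrderedField F

  commutativeRing : CommutativeRing 0ℓ 0ℓ
  commutativeRing = record { isCommutativeRing = isCommutativeRing }

  open CommutativeRing commutativeRing public
    using (_-_; +-assoc; +-comm; +-identityˡ; +-identityʳ; -‿inverseʳ;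
           *-identityˡ; *-identityʳ; distribʳ; zeroˡ; +-commutativeMonoid)
  open RingProperties (CommutativeRing.ring commutativeRing) public
    using (-‿distribˡ-*; -‿distribʳ-*; -‿+-comm; -‿involutive; -0#≈0#;
           //-rightDividesˡ; //-rightDividesʳ; x[y-z]≈xy-xz; [y-z]x≈yx-zx)
  open IsTotalOrder isTotalOrder public
    using (total; antisym) renaming (refl to ≤-refl; trans to ≤-trans; reflexive to ≤-reflexive)
  open ≡-Reasoning

  infix 4 _≤_
  _≤_ : Carrier → Carrier → Set
  _≤_ = _≤ᶠ_

  poset : Poset 0ℓ 0ℓ 0ℓ
  poset = record { isPartialOrder = IsTotalOrder.isPartialOrder isTotalOrder }

  module ≤-Reasoning = PartialOrderReasoning poset

  +-mono-≤ : ∀ {a b c d} → a ≤ b → c ≤ d → a + c ≤ b + d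
  +-mono-≤ {a} {b} {c} {d} a≤b c≤d =
    ≤-trans (+-monoˡ c a≤b) (subst₂ _≤_ (+-comm c b) (+-comm d b) (+-monoˡ b c≤d))

  +-monoʳ-≤ : ∀ {a b} c → a ≤ b → c + a ≤ c + b
  +-monoʳ-≤ c = +-mono-≤ ≤-refl

  +-cancelʳ-≤ : ∀ {a b} c → a + c ≤ b + c → a ≤ b
  +-cancelʳ-≤ {a} {b} c p = subst₂ _≤_ (//-rightDividesʳ c a) (//-rightDividesʳ c b) (+-monoˡ (- c) p)

  x≤y⇒0≤y-x : ∀ {x y} → x ≤ y → 0# ≤ y - x
  x≤y⇒0≤y-x {x} {y} p = subst (_≤ y - x) (-‿inverseʳ x) (+-monoˡ (- x) p)

  0≤y-x⇒x≤y : ∀ {x y} → 0# ≤ y - x → x ≤ y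
  0≤y-x⇒x≤y {x} {y} p = subst₂ _≤_ (+-identityˡ x) (//-rightDividesˡ x y) (+-monoˡ x p)

  x≤y⇒x-y≤0 : ∀ {x y} → x ≤ y → x - y ≤ 0#
  x≤y⇒x-y≤0 {x} {y} p = subst (x - y ≤_) (-‿inverseʳ y) (+-monoˡ (- y) p)

  neg-antimono-≤ : ∀ {x y} → x ≤ y → - y ≤ - x
  neg-antimono-≤ {x} {y} p = 0≤y-x⇒x≤y (subst (0# ≤_) (begin
    y - x         ≡⟨ +-comm y (- x) ⟩
    - x + y       ≡⟨ cong (- x +_) (-‿involutive y) ⟨
    - x - (- y)   ∎) (x≤y⇒0≤y-x p))

  x≤0⇒0≤-x : ∀ {x} → x ≤ 0# → 0# ≤ - x
  x≤0⇒0≤-x {x} p = subst (_≤ - x) -0#≈0# (neg-antimono-≤ p)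

  0≤x⇒-x≤0 : ∀ {x} → 0# ≤ x → - x ≤ 0#
  0≤x⇒-x≤0 {x} p = subst (- x ≤_) -0#≈0# (neg-antimono-≤ p)

  x≤x+y : ∀ {x y} → 0# ≤ y → x ≤ x + y
  x≤x+y {x} {y} p = subst (_≤ x + y) (+-identityʳ x) (+-monoʳ-≤ x p)

  y≤x+y : ∀ {x y} → 0# ≤ x → y ≤ x + y
  y≤x+y {x} {y} p = subst (_≤ x + y) (+-identityˡ y) (+-monoˡ y p)

  x-y≤x : ∀ {x y} → 0# ≤ y → x - y ≤ x
  x-y≤x {x} {y} p = subst (x - y ≤_) (+-identityʳ x) (+-monoʳ-≤ x (0≤x⇒-x≤0 p))

  x-0≡x : ∀ x → x - 0# ≡ x
  x-0≡x x = trans (cong (x +_) -0#≈0#) (+-identityʳ x)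

  x-[x-y]≡y : ∀ x y → x - (x - y) ≡ y
  x-[x-y]≡y x y = begin
    x - (x - y)         ≡⟨ cong (x +_) (-‿+-comm x (- y)) ⟨
    x + (- x + - - y)   ≡⟨ +-assoc x (- x) _ ⟨
    (x - x) + - - y     ≡⟨ cong₂ _+_ (-‿inverseʳ x) (-‿involutive y) ⟩
    0# + y              ≡⟨ +-identityˡ y ⟩
    y                   ∎

  y≤x-z⇒z≤x-y : ∀ {x y z} → y ≤ x - z → z ≤ x - y
  y≤x-z⇒z≤x-y {x} {y} {z} p = subst (_≤ x - y) (x-[x-y]≡y x z) (+-monoʳ-≤ x (neg-antimono-≤ p))

  *-monoˡ-≤ : ∀ {c x y} → 0# ≤ c → x ≤ y → c * x ≤ c * y
  *-monoˡ-≤ {c} {x} {y} 0≤c p =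
    0≤y-x⇒x≤y (subst (0# ≤_) (x[y-z]≈xy-xz c y x) (*-nonneg 0≤c (x≤y⇒0≤y-x p)))

  0≤1 : 0# ≤ 1#
  0≤1 with total 0# 1#
  ... | inj₁ p = p
  ... | inj₂ p = ≤-reflexive (sym (antisym p (subst (0# ≤_) [-1][-1]≡1 (*-nonneg 0≤-1 0≤-1))))
    where
    0≤-1 : 0# ≤ - 1#
    0≤-1 = x≤0⇒0≤-x p
    [-1][-1]≡1 : - 1# * - 1# ≡ 1#
    [-1][-1]≡1 = begin
      - 1# * - 1#     ≡⟨ -‿distribˡ-* 1# (- 1#) ⟨
      - (1# * - 1#)   ≡⟨ cong -_ (*-identityˡ (- 1#)) ⟩
      - - 1#          ≡⟨ -‿involutive 1# ⟩
      1#              ∎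

  1≰0 : ¬ (1# ≤ 0#)
  1≰0 1≤0 = 0≢1 (antisym 0≤1 1≤0)

  inverse-nonneg : ∀ {x} (x≢0 : x ≢ 0#) → 0# ≤ x → 0# ≤ inverse x x≢0
  inverse-nonneg {x} x≢0 0≤x with total 0# (inverse x x≢0)
  ... | inj₁ 0≤x⁻¹ = 0≤x⁻¹
  ... | inj₂ x⁻¹≤0 = ⊥-elim (1≰0 (subst₂ _≤_ (-‿involutive 1#) -0#≈0# (neg-antimono-≤ 0≤-1)))
    where
    0≤-1 : 0# ≤ - 1#
    0≤-1 = subst (0# ≤_) (trans (sym (-‿distribʳ-* x _)) (cong -_ (inverse-inv x x≢0)))
                 (*-nonneg 0≤x (x≤0⇒0≤-x x⁻¹≤0))

  inverse≤1 : ∀ {x} (x≢0 : x ≢ 0#) → 1# ≤ x → inverse x x≢0 ≤ 1#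
  inverse≤1 {x} x≢0 1≤x = 0≤y-x⇒x≤y (subst (0# ≤_) [x-1]x⁻¹≡1-x⁻¹
    (*-nonneg (x≤y⇒0≤y-x 1≤x) (inverse-nonneg x≢0 (≤-trans 0≤1 1≤x))))
    where
    [x-1]x⁻¹≡1-x⁻¹ : (x - 1#) * inverse x x≢0 ≡ 1# - inverse x x≢0
    [x-1]x⁻¹≡1-x⁻¹ = trans ([y-z]x≈yx-zx _ x 1#)
                           (cong₂ _-_ (inverse-inv x x≢0) (*-identityˡ _))

-- Indicator-weighted finite sums

module Summation (F : OrderedField) where
  open OrderedField F
  open Arithmetic F
  open ≡-Reasoning

  infixr 7 [_]·_
  [_]·_ : Bool → Carrier → Carrier
  [ b ]· x = if b then x else 0#

  []·-nonneg : ∀ b {x} → 0# ≤ x → 0# ≤ [ b ]· x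
  []·-nonneg true  p = p
  []·-nonneg false p = ≤-refl

  []·-monoʳ-≤ : ∀ b {x y} → x ≤ y → [ b ]· x ≤ [ b ]· y
  []·-monoʳ-≤ true  p = p
  []·-monoʳ-≤ false p = ≤-refl

  []·-monoˡ-≤ : ∀ {p q} → (p ≡ true → q ≡ true) → ∀ {x} → 0# ≤ x → [ p ]· x ≤ [ q ]· x
  []·-monoˡ-≤ {true}  p⇒q 0≤x rewrite p⇒q refl = ≤-refl
  []·-monoˡ-≤ {false} {q} p⇒q 0≤x = []·-nonneg q 0≤x

  []·-≤ : ∀ b {x} → 0# ≤ x → [ b ]· x ≤ x
  []·-≤ true  p = ≤-refl
  []·-≤ false p = p

  0≤x-[p]·y : ∀ p {x y} → 0# ≤ x → (p ≡ true → y ≤ x) → 0# ≤ x - [ p ]· y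
  0≤x-[p]·y true  _   y≤x = x≤y⇒0≤y-x (y≤x refl)
  0≤x-[p]·y false {x} 0≤x _ = subst (0# ≤_) (sym (x-0≡x x)) 0≤x

  []·-zero : ∀ b → [ b ]· 0# ≡ 0#
  []·-zero true  = refl
  []·-zero false = refl

  []·-distrib-+ : ∀ b x y → [ b ]· (x + y) ≡ [ b ]· x + [ b ]· y
  []·-distrib-+ true  x y = refl
  []·-distrib-+ false x y = sym (+-identityˡ 0#)

  []·-distrib-- : ∀ b x y → [ b ]· (x - y) ≡ [ b ]· x - [ b ]· y
  []·-distrib-- true  x y = refl
  []·-distrib-- false x y = sym (x-0≡x 0#)

  []·-comm : ∀ p q x → [ p ]· [ q ]· x ≡ [ q ]· [ p ]· x
  []·-comm true  q x = refl
  []·-comm false true  x = refl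
  []·-comm false false x = refl

  []·-∧ : ∀ p q x → [ p ∧ q ]· x ≡ [ p ]· [ q ]· x
  []·-∧ true  q x = refl
  []·-∧ false q x = refl

  [∧]+[∨] : ∀ p q x → [ p ∧ q ]· x + [ p ∨ q ]· x ≡ [ p ]· x + [ q ]· x
  [∧]+[∨] true  q     x = +-comm ([ q ]· x) x
  [∧]+[∨] false true  x = refl
  [∧]+[∨] false false x = refl

  -- [ p ]· x + [ q ]· x = [ p ∨ q ]· x + [ p ∧ q ]· x, so comparing disjunctions and conjunctions suffices.
  []·-exchange : ∀ {p q r s} → ((p ∨ q) ≡ true → (r ∨ s) ≡ true) → ((p ∧ q) ≡ true → (r ∧ s) ≡ true) →
                 ∀ {x} → 0# ≤ x → [ p ]· x + [ q ]· x ≤ [ r ]· x + [ s ]· x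
  []·-exchange {p} {q} {r} {s} ∨⇒∨ ∧⇒∧ {x} 0≤x =
    subst₂ _≤_ (trans (+-comm _ _) ([∧]+[∨] p q x)) (trans (+-comm _ _) ([∧]+[∨] r s x))
      (+-mono-≤ ([]·-monoˡ-≤ ∨⇒∨ 0≤x) ([]·-monoˡ-≤ ∧⇒∧ 0≤x))

  []·-squeeze : ∀ b {x y} → 0# ≤ y → y ≤ [ b ]· x → y ≡ [ b ]· y
  []·-squeeze true  0≤y y≤x = refl
  []·-squeeze false 0≤y y≤0 = antisym y≤0 0≤y

  sum : {A : Set} → List A → (A → Carrier) → Carrier
  sum []       f = 0#
  sum (a ∷ as) f = f a + sum as f

  infixr 7 sum
  syntax sum xs (λ a → e) = ∑[ a ∈ xs ] e

  module _ {A : Set} where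

    sumIf≡∑ : (xs : List A) (p : A → Bool) (f : A → Carrier) →
              sumIf F xs p f ≡ ∑[ a ∈ xs ] [ p a ]· f a
    sumIf≡∑ []       p f = refl
    sumIf≡∑ (a ∷ xs) p f with p a
    ... | true  = cong (f a +_) (sumIf≡∑ xs p f)
    ... | false = trans (sumIf≡∑ xs p f) (sym (+-identityˡ _))

    sum-cong : (xs : List A) {f g : A → Carrier} → (∀ a → f a ≡ g a) → sum xs f ≡ sum xs g
    sum-cong []       f≗g = refl
    sum-cong (a ∷ xs) f≗g = cong₂ _+_ (f≗g a) (sum-cong xs f≗g)

    sum-cong-∈ : (xs : List A) {f g : A → Carrier} → (∀ {a} → a ∈ xs → f a ≡ g a) → sum xs f ≡ sum xs g
    sum-cong-∈ []       f≗g = refl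
    sum-cong-∈ (a ∷ xs) f≗g = cong₂ _+_ (f≗g (here refl)) (sum-cong-∈ xs (f≗g ∘ there))

    sum-zero : (xs : List A) → ∑[ a ∈ xs ] 0# ≡ 0#
    sum-zero []       = refl
    sum-zero (a ∷ xs) = trans (+-identityˡ _) (sum-zero xs)

    sum-distrib-+ : (xs : List A) (f g : A → Carrier) → ∑[ a ∈ xs ] (f a + g a) ≡ sum xs f + sum xs g
    sum-distrib-+ []       f g = sym (+-identityˡ 0#)
    sum-distrib-+ (a ∷ xs) f g = begin
      (f a + g a) + ∑[ b ∈ xs ] (f b + g b)   ≡⟨ cong (f a + g a +_) (sum-distrib-+ xs f g) ⟩
      (f a + g a) + (sum xs f + sum xs g)
        ≡⟨ solve 4 (λ x y u v → (x ⊕ y) ⊕ (u ⊕ v) ⊜ (x ⊕ u) ⊕ (y ⊕ v)) refl (f a) (g a) (sum xs f) (sum xs g) ⟩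
      (f a + sum xs f) + (g a + sum xs g)     ∎
      where open CommutativeMonoidSolver +-commutativeMonoid using (solve; _⊕_; _⊜_)

    sum-neg : (xs : List A) (f : A → Carrier) → ∑[ a ∈ xs ] - f a ≡ - sum xs f
    sum-neg []       f = sym -0#≈0#
    sum-neg (a ∷ xs) f = trans (cong (- f a +_) (sum-neg xs f)) (-‿+-comm (f a) _)

    sum-distrib-- : (xs : List A) (f g : A → Carrier) → ∑[ a ∈ xs ] (f a - g a) ≡ sum xs f - sum xs g
    sum-distrib-- xs f g = trans (sum-distrib-+ xs f (λ a → - g a)) (cong (sum xs f +_) (sum-neg xs g))

    sum-*ʳ : (xs : List A) (f : A → Carrier) (k : Carrier) → ∑[ a ∈ xs ] (f a * k) ≡ sum xs f * k
    sum-*ʳ []       f k = sym (zeroˡ k)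
    sum-*ʳ (a ∷ xs) f k = trans (cong (f a * k +_) (sum-*ʳ xs f k)) (sym (distribʳ k (f a) _))

    sum-[]· : (xs : List A) (b : Bool) (f : A → Carrier) → ∑[ a ∈ xs ] [ b ]· f a ≡ [ b ]· sum xs f
    sum-[]· xs true  f = refl
    sum-[]· xs false f = sum-zero xs

    sum-++ : (xs ys : List A) (f : A → Carrier) → sum (xs ++ ys) f ≡ sum xs f + sum ys f
    sum-++ []       ys f = sym (+-identityˡ _)
    sum-++ (a ∷ xs) ys f = trans (cong (f a +_) (sum-++ xs ys f)) (sym (+-assoc (f a) _ _))

    sum-mono-≤ : (xs : List A) {f g : A → Carrier} → (∀ a → f a ≤ g a) → sum xs f ≤ sum xs g
    sum-mono-≤ []       f≤g = ≤-refl
    sum-mono-≤ (a ∷ xs) f≤g = +-mono-≤ (f≤g a) (sum-mono-≤ xs f≤g)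

    sum-nonneg : (xs : List A) {f : A → Carrier} → (∀ a → 0# ≤ f a) → 0# ≤ sum xs f
    sum-nonneg xs {f} 0≤f = subst (_≤ sum xs f) (sum-zero xs) (sum-mono-≤ xs 0≤f)

    ∈⇒≤sum : (xs : List A) {f : A → Carrier} → (∀ a → 0# ≤ f a) → ∀ {a} → a ∈ xs → f a ≤ sum xs f
    ∈⇒≤sum (a ∷ xs) 0≤f (here refl) = x≤x+y (sum-nonneg xs 0≤f)
    ∈⇒≤sum (b ∷ xs) {f} 0≤f (there a∈xs) =
      ≤-trans (∈⇒≤sum xs 0≤f a∈xs) (subst (_≤ f b + sum xs f) (+-identityˡ _) (+-monoˡ (sum xs f) (0≤f b)))

    sum-select : (_≟_ : DecidableEquality A) {xs : List A} → Unique xs → ∀ {u} → u ∈ xs →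
                 (f : A → Carrier) → ∑[ a ∈ xs ] [ does (a ≟ u) ]· f a ≡ f u
    sum-select _≟_ {a ∷ xs} (a∉xs ∷ xs!) {u} u∈ f with a ≟ u | u∈
    ... | yes refl | _          = trans (cong (f a +_) (sum-absent a∉xs)) (+-identityʳ (f a))
      where
      sum-absent : ∀ {ys} → All (a ≢_) ys → ∑[ b ∈ ys ] [ does (b ≟ a) ]· f b ≡ 0#
      sum-absent []            = refl
      sum-absent {b ∷ ys} (a≢b ∷ a∉ys) with b ≟ a
      ... | yes refl = ⊥-elim (a≢b refl)
      ... | no  _    = trans (+-identityˡ _) (sum-absent a∉ys)
    ... | no a≢u   | here refl  = ⊥-elim (a≢u refl)
    ... | no _     | there u∈xs = trans (+-identityˡ _) (sum-select _≟_ xs! u∈xs f)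

  module _ {A B : Set} where

    sum-map : (xs : List A) (g : A → B) (f : B → Carrier) → sum (map g xs) f ≡ ∑[ a ∈ xs ] f (g a)
    sum-map []       g f = refl
    sum-map (a ∷ xs) g f = cong (f (g a) +_) (sum-map xs g f)

    sum-comm : (xs : List A) (ys : List B) (f : A → B → Carrier) →
               ∑[ a ∈ xs ] ∑[ b ∈ ys ] f a b ≡ ∑[ b ∈ ys ] ∑[ a ∈ xs ] f a b
    sum-comm []       ys f = sym (sum-zero ys)
    sum-comm (a ∷ xs) ys f = begin
      sum ys (f a) + ∑[ a′ ∈ xs ] sum ys (f a′)          ≡⟨ cong (sum ys (f a) +_) (sum-comm xs ys f) ⟩
      sum ys (f a) + ∑[ b ∈ ys ] ∑[ a′ ∈ xs ] f a′ b     ≡⟨ sum-distrib-+ ys (f a) _ ⟨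
      ∑[ b ∈ ys ] (f a b + ∑[ a′ ∈ xs ] f a′ b)          ∎

  sum-upairs : {A : Set} (xs : List A) (G : A → A → Carrier) →
               ∑[ a ∈ xs ] ∑[ b ∈ xs ] G a b ≡ (sum (upairs xs) λ (a , b) → G a b + G b a) + ∑[ a ∈ xs ] G a a
  sum-upairs []           G = sym (+-identityˡ 0#)
  sum-upairs {A} (a ∷ xs) G = begin
    (G a a + P) + ∑[ b ∈ xs ] (G b a + sum xs (G b))
      ≡⟨ cong ((G a a + P) +_) (trans (sum-distrib-+ xs (λ b → G b a) (λ b → sum xs (G b))) (cong (Q +_) (sum-upairs xs G))) ⟩
    (G a a + P) + (Q + (U + D))
      ≡⟨ solve 5 (λ gaa p q u d → (gaa ⊕ p) ⊕ (q ⊕ (u ⊕ d)) ⊜ ((p ⊕ q) ⊕ u) ⊕ (gaa ⊕ d)) refl (G a a) P Q U D ⟩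
    ((P + Q) + U) + (G a a + D)
      ≡⟨ cong (λ z → (z + U) + (G a a + D)) (sym (trans (sum-map xs (a ,_) H) (sum-distrib-+ xs (G a) (λ b → G b a)))) ⟩
    (sum (map (a ,_) xs) H + U) + (G a a + D)
      ≡⟨ cong (_+ (G a a + D)) (sym (sum-++ (map (a ,_) xs) (upairs xs) H)) ⟩
    sum (map (a ,_) xs ++ upairs xs) H + (G a a + D) ∎
    where
    open CommutativeMonoidSolver +-commutativeMonoid using (solve; _⊕_; _⊜_)
    H : A × A → Carrier
    H p = G (proj₁ p) (proj₂ p) + G (proj₂ p) (proj₁ p)
    P Q U D : Carrier
    P = sum xs (G a)
    Q = ∑[ b ∈ xs ] G b a
    U = sum (upairs xs) H
    D = ∑[ b ∈ xs ] G b b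

-- Unit flows from the cut condition

module CutFlow (F : OrderedField) {V : Set} (_≟_ : DecidableEquality V)
               (vs : List V) (∈vs : ∀ v → v ∈ vs) (vs! : Unique vs) where
  open OrderedField F
  open Arithmetic F
  open Summation F
  open ≡-Reasoning

  infix 7 _==_
  _==_ : V → V → Bool
  a == b = does (a ≟ b)

  ==⇒≡ : ∀ {a b} → (a == b) ≡ true → a ≡ b
  ==⇒≡ {a} {b} a==b with a ≟ b
  ... | yes a≡b = a≡b

  ==-refl : ∀ a → (a == a) ≡ true
  ==-refl a with a ≟ a
  ... | yes _  = refl
  ... | no a≢a = ⊥-elim (a≢a refl)

  ≢⇒==-false : ∀ {a b} → a ≢ b → (a == b) ≡ false
  ≢⇒==-false {a} {b} a≢b with a ≟ b
  ... | yes a≡b = ⊥-elim (a≢b a≡b)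
  ... | no  _   = refl

  sum-select-V : ∀ u (f : V → Carrier) → ∑[ a ∈ vs ] [ a == u ]· f a ≡ f u
  sum-select-V u = sum-select _≟_ vs! (∈vs u)

  Capacities : Set
  Capacities = V → V → Carrier

  Cut : Set
  Cut = V → Bool

  Nonneg : Capacities → Set
  Nonneg c = ∀ a b → 0# ≤ c a b

  cap : Capacities → Cut → Carrier
  cap c S = ∑[ a ∈ vs ] ∑[ b ∈ vs ] [ S a ∧ not (S b) ]· c a b

  outAt inAt : Capacities → V → Carrier
  outAt c u = ∑[ b ∈ vs ] c u b
  inAt  c u = ∑[ a ∈ vs ] c a u

  transpose : Capacities → Capacities
  transpose c a b = c b a

  Separates : V → V → Cut → Set
  Separates s t S = (S s ≡ true) × (S t ≡ false)

  CutCondition : V → V → Capacities → Set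
  CutCondition s t c = ∀ S → Separates s t S → 1# ≤ cap c S

  _∩ᶜ_ _∪ᶜ_ : Cut → Cut → Cut
  (S ∩ᶜ T) x = S x ∧ T x
  (S ∪ᶜ T) x = S x ∨ T x

  cap-cong : ∀ c {S T : Cut} → (∀ x → S x ≡ T x) → cap c S ≡ cap c T
  cap-cong c S≗T = sum-cong vs λ a → sum-cong vs λ b → cong₂ (λ p q → [ p ∧ not q ]· c a b) (S≗T a) (S≗T b)

  cap-mono-≤ : ∀ {c d} → (∀ a b → c a b ≤ d a b) → ∀ S → cap c S ≤ cap d S
  cap-mono-≤ c≤d S = sum-mono-≤ vs λ a → sum-mono-≤ vs λ b → []·-monoʳ-≤ (S a ∧ not (S b)) (c≤d a b)

  crossing≤cap : ∀ {c} → Nonneg c → ∀ S {a b} → S a ≡ true → S b ≡ false → c a b ≤ cap c S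
  crossing≤cap {c} c≥0 S {a} {b} Sa Sb =
    ≤-trans (subst (λ p → [ p ]· c a b ≤ _) (cong₂ (λ p q → p ∧ not q) Sa Sb)
              (∈⇒≤sum vs (λ b′ → []·-nonneg (S a ∧ not (S b′)) (c≥0 a b′)) (∈vs b)))
            (∈⇒≤sum vs (λ a′ → sum-nonneg vs λ b′ → []·-nonneg (S a′ ∧ not (S b′)) (c≥0 a′ b′)) (∈vs a))

  cap-transpose : ∀ c S → cap (transpose c) S ≡ cap c (not ∘ S)
  cap-transpose c S = begin
    ∑[ a ∈ vs ] ∑[ b ∈ vs ] [ S a ∧ not (S b) ]· c b a           ≡⟨ sum-comm vs vs _ ⟩
    ∑[ b ∈ vs ] ∑[ a ∈ vs ] [ S a ∧ not (S b) ]· c b a           ≡⟨ sum-cong vs (λ b → sum-cong vs λ a →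
                                                                      cong (λ p → [ p ]· c b a) (flip-∧ (S a) (S b))) ⟩
    ∑[ b ∈ vs ] ∑[ a ∈ vs ] [ not (S b) ∧ not (not (S a)) ]· c b a  ∎
    where
    flip-∧ : ∀ p q → (p ∧ not q) ≡ (not q ∧ not (not p))
    flip-∧ p q = trans (∧-comm p (not q)) (cong (not q ∧_) (sym (not-involutive p)))

  cap-submodular : ∀ {c} → Nonneg c → ∀ S T → cap c (S ∩ᶜ T) + cap c (S ∪ᶜ T) ≤ cap c S + cap c T
  cap-submodular {c} c≥0 S T =
    subst₂ _≤_ (sum₂-distrib-+ _ _) (sum₂-distrib-+ _ _)
      (sum-mono-≤ vs λ a → sum-mono-≤ vs λ b → pointwise (S a) (T a) (S b) (T b) (c≥0 a b))
    where
    sum₂-distrib-+ : (f g : V → V → Carrier) → ∑[ a ∈ vs ] ∑[ b ∈ vs ] (f a b + g a b)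
                     ≡ ∑[ a ∈ vs ] ∑[ b ∈ vs ] f a b + ∑[ a ∈ vs ] ∑[ b ∈ vs ] g a b
    sum₂-distrib-+ f g = trans (sum-cong vs λ a → sum-distrib-+ vs (f a) (g a)) (sum-distrib-+ vs _ _)
    pointwise : ∀ sa ta sb tb {x} → 0# ≤ x → [ (sa ∧ ta) ∧ not (sb ∧ tb) ]· x + [ (sa ∨ ta) ∧ not (sb ∨ tb) ]· x
                                             ≤ [ sa ∧ not sb ]· x + [ ta ∧ not tb ]· x
    pointwise true  true  true  tb    {x} _   = ≤-reflexive (+-comm ([ not tb ]· x) 0#)
    pointwise true  true  false tb        _   = ≤-refl
    pointwise true  false true  tb        _   = ≤-refl
    pointwise true  false false tb    {x} 0≤x = subst (0# + [ not tb ]· x ≤_) (+-comm 0# x) (+-monoʳ-≤ 0# ([]·-≤ (not tb) 0≤x))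
    pointwise false true  true  tb    {x} 0≤x = +-mono-≤ ≤-refl ([]·-nonneg (not tb) 0≤x)
    pointwise false true  false tb        _   = ≤-refl
    pointwise false false sb    tb        _   = ≤-refl

  set : Cut → V → Bool → Cut
  set S v b x = if x == v then b else S x

  cuts : List V → List Cut
  cuts []       = (λ _ → false) ∷ []
  cuts (v ∷ us) = map (λ S → set S v true) (cuts us) ++ map (λ S → set S v false) (cuts us)

  cuts-complete : (S : Cut) → Σ Cut λ S′ → S′ ∈ cuts vs × (∀ x → S x ≡ S′ x)
  cuts-complete S = let S′ , S′∈ , S≗S′ = go vs in S′ , S′∈ , λ x → S≗S′ (∈vs x)
    where
    go : ∀ us → Σ Cut λ S′ → S′ ∈ cuts us × (∀ {x} → x ∈ us → S x ≡ S′ x)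
    go []       = (λ _ → false) , here refl , λ ()
    go (v ∷ us) = let S′ , S′∈ , S≗S′ = go us in set S′ v (S v) , member (S v) S′∈ , agree S≗S′
      where
      member : ∀ b {S′} → S′ ∈ cuts us → set S′ v b ∈ cuts (v ∷ us)
      member true  S′∈ = ∈-++⁺ˡ (∈-map⁺ (λ T → set T v true) S′∈)
      member false S′∈ = ∈-++⁺ʳ (map (λ T → set T v true) (cuts us)) (∈-map⁺ (λ T → set T v false) S′∈)
      agree : ∀ {S′} → (∀ {x} → x ∈ us → S x ≡ S′ x) → ∀ {x} → x ∈ v ∷ us → S x ≡ set S′ v (S v) x
      agree S≗S′ {x} x∈ with x ≟ v | x∈
      ... | yes refl | _          = refl
      ... | no x≢v   | here x≡v   = ⊥-elim (x≢v x≡v)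
      ... | no _     | there x∈us = S≗S′ x∈us

  Crosses : V → V → V → V → Cut → Set
  Crosses s t a b S = Separates s t S × (S a ≡ true) × (S b ≡ false)

  crosses? : ∀ s t a b → Decidable (Crosses s t a b)
  crosses? s t a b S = ((S s ≟ᵇ true) ×-dec (S t ≟ᵇ false)) ×-dec (S a ≟ᵇ true) ×-dec (S b ≟ᵇ false)

  crosses-cong : ∀ {s t a b} {S T : Cut} → (∀ x → S x ≡ T x) → Crosses s t a b S → Crosses s t a b T
  crosses-cong {s} {t} {a} {b} S≗T ((Ss , St) , Sa , Sb) =
    (trans (sym (S≗T s)) Ss , trans (sym (S≗T t)) St) , trans (sym (S≗T a)) Sa , trans (sym (S≗T b)) Sb

  TightArc : V → V → Capacities → V → V → Set
  TightArc s t c a b = (c a b ≡ 0#) ⊎ Σ Cut λ S → Crosses s t a b S × cap c S ≤ 1#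

  tight-antimono : ∀ {s t c d} → Nonneg d → (∀ x y → d x y ≤ c x y) → ∀ {a b} → TightArc s t c a b → TightArc s t d a b
  tight-antimono d≥0 d≤c {a} {b} (inj₁ cab≡0)        = inj₁ (antisym (subst (_ ≤_) cab≡0 (d≤c a b)) (d≥0 a b))
  tight-antimono d≥0 d≤c         (inj₂ (S , S× , ≤1)) = inj₂ (S , S× , ≤-trans (cap-mono-≤ d≤c S) ≤1)

  totalOrder : TotalOrder 0ℓ 0ℓ 0ℓ
  totalOrder = record { isTotalOrder = isTotalOrder }

  open Extrema totalOrder using (min; min≤⊤; min≤v⁺; argmin-sel)

  -- The largest amount by which c a b can be lowered without violating the cut condition.
  slack : V → V → Capacities → V → V → Carrier
  slack s t c a b = min (c a b) (map (λ S → cap c S - 1#) (filter (crosses? s t a b) (cuts vs)))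

  lower : V → V → Capacities → V → V → Capacities
  lower s t c a b x y = c x y - [ x == a ∧ y == b ]· slack s t c a b

  sum-select₂ : ∀ a b (g : V → V → Carrier) → ∑[ x ∈ vs ] ∑[ y ∈ vs ] [ x == a ∧ y == b ]· g x y ≡ g a b
  sum-select₂ a b g = begin
    ∑[ x ∈ vs ] ∑[ y ∈ vs ] [ x == a ∧ y == b ]· g x y
      ≡⟨ sum-cong vs (λ x → trans (sum-cong vs λ y → []·-∧ (x == a) (y == b) (g x y)) (sum-[]· vs (x == a) _)) ⟩
    ∑[ x ∈ vs ] [ x == a ]· ∑[ y ∈ vs ] [ y == b ]· g x y
      ≡⟨ sum-cong vs (λ x → cong ([ x == a ]·_) (sum-select-V b (g x))) ⟩
    ∑[ x ∈ vs ] [ x == a ]· g x b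
      ≡⟨ sum-select-V a (λ x → g x b) ⟩
    g a b ∎

  cap-lower : ∀ s t c a b S → cap (lower s t c a b) S ≡ cap c S - [ S a ∧ not (S b) ]· slack s t c a b
  cap-lower s t c a b S = begin
    ∑[ x ∈ vs ] ∑[ y ∈ vs ] [ S x ∧ not (S y) ]· (c x y - [ x == a ∧ y == b ]· r)
      ≡⟨ sum-cong vs (λ x → trans (sum-cong vs λ y → []·-distrib-- (S x ∧ not (S y)) _ _) (sum-distrib-- vs _ _)) ⟩
    ∑[ x ∈ vs ] (∑[ y ∈ vs ] [ S x ∧ not (S y) ]· c x y - ∑[ y ∈ vs ] [ S x ∧ not (S y) ]· [ x == a ∧ y == b ]· r)
      ≡⟨ sum-distrib-- vs _ _ ⟩
    cap c S - ∑[ x ∈ vs ] ∑[ y ∈ vs ] [ S x ∧ not (S y) ]· [ x == a ∧ y == b ]· r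
      ≡⟨ cong (λ z → cap c S - z) (trans (sum-cong vs λ x → sum-cong vs λ y → []·-comm (S x ∧ not (S y)) _ r)
                                  (sum-select₂ a b (λ x y → [ S x ∧ not (S y) ]· r))) ⟩
    cap c S - [ S a ∧ not (S b) ]· r ∎
    where
    r : Carrier
    r = slack s t c a b

  module Lowering (s t : V) (c : Capacities) (c≥0 : Nonneg c) (cut≥1 : CutCondition s t c) (a b : V) where

    private
      r : Carrier
      r = slack s t c a b
      candidates : List Cut
      candidates = filter (crosses? s t a b) (cuts vs)

    slack≤c : r ≤ c a b
    slack≤c = min≤⊤ (c a b) (map (λ S → cap c S - 1#) candidates)

    slack≤cap-1 : ∀ S → Crosses s t a b S → r ≤ cap c S - 1#
    slack≤cap-1 S S× =
      let S′ , S′∈ , S≗S′ = cuts-complete S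
          S′∈candidates = ∈-filter⁺ (crosses? s t a b) S′∈ (crosses-cong S≗S′ S×) in
      subst (λ z → r ≤ z - 1#) (sym (cap-cong c S≗S′))
        (min≤v⁺ (c a b) (map (λ S → cap c S - 1#) candidates)
                (inj₂ (lose (∈-map⁺ (λ T → cap c T - 1#) S′∈candidates) ≤-refl)))

    slack-attained : (r ≡ c a b) ⊎ Σ Cut λ S → Crosses s t a b S × r ≡ cap c S - 1#
    slack-attained with argmin-sel (λ x → x) (c a b) (map (λ S → cap c S - 1#) candidates)
    ... | inj₁ r≡c = inj₁ r≡c
    ... | inj₂ r∈  = let S , S∈ , r≡ = ∈-map⁻ (λ S → cap c S - 1#) r∈ in
                     inj₂ (S , proj₂ (∈-filter⁻ (crosses? s t a b) {xs = cuts vs} S∈) , r≡)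

    0≤slack : 0# ≤ r
    0≤slack with slack-attained
    ... | inj₁ r≡c           = subst (0# ≤_) (sym r≡c) (c≥0 a b)
    ... | inj₂ (S , S× , r≡) = subst (0# ≤_) (sym r≡) (x≤y⇒0≤y-x (cut≥1 S (proj₁ S×)))

    lower≤c : ∀ x y → lower s t c a b x y ≤ c x y
    lower≤c x y = x-y≤x ([]·-nonneg (x == a ∧ y == b) 0≤slack)

    lower-nonneg : Nonneg (lower s t c a b)
    lower-nonneg x y = 0≤x-[p]·y (x == a ∧ y == b) (c≥0 x y) at-arc
      where
      at-arc : (x == a ∧ y == b) ≡ true → r ≤ c x y
      at-arc xy==ab with ∧-true⁻ xy==ab
      ... | x==a , y==b rewrite ==⇒≡ x==a | ==⇒≡ y==b = slack≤c

    lower-cutCondition : CutCondition s t (lower s t c a b)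
    lower-cutCondition S S-sep = subst (1# ≤_) (sym (cap-lower s t c a b S)) (y≤x-z⇒z≤x-y bound)
      where
      bound : [ S a ∧ not (S b) ]· r ≤ cap c S - 1#
      bound with S a in Sa | S b in Sb
      ... | true  | false = slack≤cap-1 S (S-sep , Sa , Sb)
      ... | true  | true  = x≤y⇒0≤y-x (cut≥1 S S-sep)
      ... | false | _     = x≤y⇒0≤y-x (cut≥1 S S-sep)

    lower-tight : TightArc s t (lower s t c a b) a b
    lower-tight with slack-attained
    ... | inj₁ r≡c = inj₁ (begin
      c a b - [ a == a ∧ b == b ]· r ≡⟨ cong₂ (λ p q → c a b - [ p ∧ q ]· r) (==-refl a) (==-refl b) ⟩
      c a b - r                      ≡⟨ cong (λ z → c a b - z) r≡c ⟩
      c a b - c a b                  ≡⟨ -‿inverseʳ (c a b) ⟩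
      0#                             ∎)
    ... | inj₂ (S , S×@(_ , Sa , Sb) , r≡) = inj₂ (S , S× , ≤-reflexive (begin
      cap (lower s t c a b) S          ≡⟨ cap-lower s t c a b S ⟩
      cap c S - [ S a ∧ not (S b) ]· r ≡⟨ cong₂ (λ p q → cap c S - [ p ∧ not q ]· r) Sa Sb ⟩
      cap c S - r                      ≡⟨ cong (λ z → cap c S - z) r≡ ⟩
      cap c S - (cap c S - 1#)         ≡⟨ x-[x-y]≡y (cap c S) 1# ⟩
      1#                               ∎))

  module _ (s t : V) where

    Admissible : Capacities → Set
    Admissible c = Nonneg c × CutCondition s t c

    lowerAll : List (V × V) → Capacities → Capacities
    lowerAll []             c = c
    lowerAll ((a , b) ∷ ps) c = lowerAll ps (lower s t c a b)

    lower-admissible : ∀ {c} → Admissible c → ∀ a b → Admissible (lower s t c a b)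
    lower-admissible (c≥0 , cut≥1) a b = let open Lowering s t _ c≥0 cut≥1 a b in lower-nonneg , lower-cutCondition

    lowerAll-admissible : ∀ ps {c} → Admissible c → Admissible (lowerAll ps c)
    lowerAll-admissible []             adm = adm
    lowerAll-admissible ((a , b) ∷ ps) adm = lowerAll-admissible ps (lower-admissible adm a b)

    lowerAll≤ : ∀ ps {c} → Admissible c → ∀ x y → lowerAll ps c x y ≤ c x y
    lowerAll≤ []             adm x y = ≤-refl
    lowerAll≤ ((a , b) ∷ ps) adm@(c≥0 , cut≥1) x y =
      ≤-trans (lowerAll≤ ps (lower-admissible adm a b) x y) (Lowering.lower≤c s t _ c≥0 cut≥1 a b x y)

    lowerAll-tight : ∀ ps {c} → Admissible c → ∀ {a b} → (a , b) ∈ ps → TightArc s t (lowerAll ps c) a b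
    lowerAll-tight ((a , b) ∷ ps) {c} adm@(c≥0 , cut≥1) (here refl) =
      tight-antimono (proj₁ (lowerAll-admissible ps adm′)) (lowerAll≤ ps adm′) (Lowering.lower-tight s t _ c≥0 cut≥1 a b)
      where
      adm′ : Admissible (lower s t c a b)
      adm′ = lower-admissible adm a b
    lowerAll-tight ((a , b) ∷ ps) adm (there ab∈ps) = lowerAll-tight ps (lower-admissible adm a b) ab∈ps

  module Conservation (s t : V) (c : Capacities) (c≥0 : Nonneg c) (cut≥1 : CutCondition s t c)
                      (tight : ∀ a b → TightArc s t c a b) where

    TightCut : Cut → Set
    TightCut T = Separates s t T × cap c T ≤ 1#

    tight-∩ : ∀ {S T} → TightCut S → TightCut T → TightCut (S ∩ᶜ T)
    tight-∩ {S} {T} ((Ss , St) , S≤1) ((Ts , Tt) , T≤1) =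
      (cong₂ _∧_ Ss Ts , cong (_∧ T t) St) ,
      +-cancelʳ-≤ 1# (≤-trans (+-monoʳ-≤ (cap c (S ∩ᶜ T)) (cut≥1 (S ∪ᶜ T) (cong (_∨ T s) Ss , cong₂ _∨_ St Tt)))
                              (≤-trans (cap-submodular c≥0 S T) (+-mono-≤ S≤1 T≤1)))

    -- Intersect the tight cuts of the arcs leaving u; by submodularity the intersection stays tight.
    isolating : ∀ u ws → (∀ {w} → w ∈ ws → c u w ≡ 0#)
                       ⊎ Σ Cut λ T → TightCut T × T u ≡ true × (∀ {w} → w ∈ ws → T w ≡ true → c u w ≡ 0#)
    isolating u []       = inj₁ λ ()
    isolating u (w ∷ ws) with tight u w | isolating u ws
    ... | inj₁ cuw≡0 | inj₁ rest≡0 = inj₁ λ { (here refl) → cuw≡0 ; (there w∈) → rest≡0 w∈ }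
    ... | inj₁ cuw≡0 | inj₂ (T , T-tight , Tu , inside≡0) =
      inj₂ (T , T-tight , Tu , λ { (here refl) _ → cuw≡0 ; (there w∈) → inside≡0 w∈ })
    ... | inj₂ (S , (S-sep , Su , Sw) , S≤1) | inj₁ rest≡0 =
      inj₂ (S , (S-sep , S≤1) , Su , λ { (here refl) Sw′ → case trans (sym Sw) Sw′ of λ () ; (there w∈) _ → rest≡0 w∈ })
    ... | inj₂ (S , (S-sep , Su , Sw) , S≤1) | inj₂ (T , T-tight , Tu , inside≡0) =
      inj₂ (T ∩ᶜ S , tight-∩ T-tight (S-sep , S≤1) , cong₂ _∧_ Tu Su ,
            λ { (here refl) TSw → case trans (sym Sw) (proj₂ (∧-true⁻ TSw)) of λ ()
              ; (there w∈) TSw → inside≡0 w∈ (proj₁ (∧-true⁻ TSw)) })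

    -- Taking u out of T loses the arcs out of u and gains at most the arcs into u.
    cap-remove : ∀ {T} u → T u ≡ true → (∀ w → T w ≡ true → c u w ≡ 0#) →
                 cap c (λ x → T x ∧ not (x == u)) ≤ cap c T + (inAt c u - outAt c u)
    cap-remove {T} u Tu inside≡0 =
      subst (cap c T′ ≤_) sum-rhs (sum-mono-≤ vs λ a → sum-mono-≤ vs λ b →
        pointwise (T a) (T b) (a == u) (b == u) (c≥0 a b)
          (λ a==u → trans (cong T (==⇒≡ a==u)) Tu) (λ b==u → trans (cong T (==⇒≡ b==u)) Tu)
          (λ a==u Tb → subst (λ a → c a b ≡ 0#) (sym (==⇒≡ a==u)) (inside≡0 b Tb)))
      where
      T′ : Cut
      T′ x = T x ∧ not (x == u)
      0+[0-0]≡0 : 0# + (0# - 0#) ≡ 0#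
      0+[0-0]≡0 = trans (+-identityˡ _) (-‿inverseʳ 0#)
      pointwise : ∀ ta tb au bu {x} → 0# ≤ x → (au ≡ true → ta ≡ true) → (bu ≡ true → tb ≡ true) →
                  (au ≡ true → tb ≡ true → x ≡ 0#) →
                  [ (ta ∧ not au) ∧ not (tb ∧ not bu) ]· x ≤ [ ta ∧ not tb ]· x + ([ bu ]· x - [ au ]· x)
      pointwise true  true  true  true  {x} _   _  _  _    = ≤-reflexive (sym (trans (+-identityˡ _) (-‿inverseʳ x)))
      pointwise true  true  true  false     _   _  _  x≡0 rewrite x≡0 refl refl = ≤-reflexive (sym 0+[0-0]≡0)
      pointwise true  true  false true  {x} _   _  _  _    = ≤-reflexive (sym (trans (+-identityˡ _) (x-0≡x x)))
      pointwise true  true  false false     _   _  _  _    = ≤-reflexive (sym 0+[0-0]≡0)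
      pointwise true  false true  false {x} _   _  _  _    = ≤-reflexive (sym (trans (cong (x +_) (+-identityˡ (- x))) (-‿inverseʳ x)))
      pointwise true  false false false {x} _   _  _  _    = ≤-reflexive (sym (trans (cong (x +_) (-‿inverseʳ 0#)) (+-identityʳ x)))
      pointwise false true  false true  {x} 0≤x _  _  _    = subst (0# ≤_) (sym (trans (+-identityˡ _) (x-0≡x x))) 0≤x
      pointwise false true  false false     _   _  _  _    = ≤-reflexive (sym 0+[0-0]≡0)
      pointwise false false false false     _   _  _  _    = ≤-reflexive (sym 0+[0-0]≡0)
      pointwise _     false _     true      _   _  tb  _   = case tb refl of λ ()
      pointwise false _     true  _         _   ta _   _   = case ta refl of λ ()
      sum-rhs : ∑[ a ∈ vs ] ∑[ b ∈ vs ] ([ T a ∧ not (T b) ]· c a b + ([ b == u ]· c a b - [ a == u ]· c a b))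
                ≡ cap c T + (inAt c u - outAt c u)
      sum-rhs = begin
        ∑[ a ∈ vs ] ∑[ b ∈ vs ] ([ T a ∧ not (T b) ]· c a b + ([ b == u ]· c a b - [ a == u ]· c a b))
          ≡⟨ sum-cong vs (λ a → trans (sum-distrib-+ vs _ _) (cong (∑[ b ∈ vs ] [ T a ∧ not (T b) ]· c a b +_) (sum-distrib-- vs _ _))) ⟩
        ∑[ a ∈ vs ] (∑[ b ∈ vs ] [ T a ∧ not (T b) ]· c a b
                     + (∑[ b ∈ vs ] [ b == u ]· c a b - ∑[ b ∈ vs ] [ a == u ]· c a b))
          ≡⟨ trans (sum-distrib-+ vs _ _) (cong (cap c T +_) (sum-distrib-- vs _ _)) ⟩
        cap c T + (∑[ a ∈ vs ] ∑[ b ∈ vs ] [ b == u ]· c a b - ∑[ a ∈ vs ] ∑[ b ∈ vs ] [ a == u ]· c a b)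
          ≡⟨ cong₂ (λ p q → cap c T + (p - q)) (sum-cong vs λ a → sum-select-V u (c a))
                                                 (trans (sum-cong vs λ a → sum-[]· vs (a == u) (c a)) (sum-select-V u (outAt c))) ⟩
        cap c T + (inAt c u - outAt c u) ∎

    out≤in : ∀ u → u ≢ s → u ≢ t → outAt c u ≤ inAt c u
    out≤in u u≢s u≢t with isolating u vs
    ... | inj₁ out≡0 = subst (_≤ inAt c u) (sym (trans (sum-cong-∈ vs out≡0) (sum-zero vs))) (sum-nonneg vs λ a → c≥0 a u)
    ... | inj₂ (T , ((Ts , Tt) , T≤1) , Tu , inside≡0) =
      0≤y-x⇒x≤y (+-cancelʳ-≤ 1# (subst₂ _≤_ (sym (+-identityˡ 1#)) (+-comm 1# _)
        (≤-trans (cut≥1 T′ T′-sep) (≤-trans (cap-remove u Tu (λ w → inside≡0 (∈vs w))) (+-monoˡ _ T≤1)))))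
      where
      T′ : Cut
      T′ x = T x ∧ not (x == u)
      T′-sep : Separates s t T′
      T′-sep = cong₂ (λ p q → p ∧ not q) Ts (≢⇒==-false (u≢s ∘ sym)) , cong (λ p → p ∧ not (t == u)) Tt

    inAt-source≡0 : inAt c s ≡ 0#
    inAt-source≡0 = trans (sum-cong vs into-s≡0) (sum-zero vs)
      where
      into-s≡0 : ∀ a → c a s ≡ 0#
      into-s≡0 a with tight a s
      ... | inj₁ cas≡0                        = cas≡0
      ... | inj₂ (S , ((Ss , _) , _ , S′s) , _) = case trans (sym Ss) S′s of λ ()

    1≤outAt-source : t ≢ s → 1# ≤ outAt c s
    1≤outAt-source t≢s = ≤-trans (cut≥1 (_== s) (==-refl s , ≢⇒==-false t≢s))
      (subst (cap c (_== s) ≤_) (trans (sum-cong vs λ a → sum-[]· vs (a == s) (c a)) (sum-select-V s (outAt c)))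
        (sum-mono-≤ vs λ a → sum-mono-≤ vs λ b →
          subst (_≤ [ a == s ]· c a b) (sym ([]·-∧ (a == s) _ (c a b))) ([]·-monoʳ-≤ (a == s) ([]·-≤ _ (c≥0 a b)))))

  transpose-cutCondition : ∀ {s t c} → CutCondition s t c → CutCondition t s (transpose c)
  transpose-cutCondition {c = c} cut≥1 S (St , Ss) =
    subst (1# ≤_) (sym (cap-transpose c S)) (cut≥1 (not ∘ S) (cong not Ss , cong not St))

  transpose-tight : ∀ {s t c a b} → TightArc s t c a b → TightArc t s (transpose c) b a
  transpose-tight (inj₁ cab≡0) = inj₁ cab≡0
  transpose-tight {c = c} (inj₂ (S , ((Ss , St) , Sa , Sb) , S≤1)) =
    inj₂ (not ∘ S , ((cong not St , cong not Ss) , cong not Sb , cong not Sa) ,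
          subst (_≤ 1#) (sym (trans (cap-transpose c (not ∘ S)) (cap-cong c (not-involutive ∘ S)))) S≤1)

  IsUnitFlowWithin : V → V → Capacities → Capacities → Set
  IsUnitFlowWithin s t c h = Nonneg h × (∀ a b → h a b ≤ c a b)
                           × (∀ u → u ≢ s → u ≢ t → inAt h u ≡ outAt h u) × (outAt h s - inAt h s ≡ 1#)

  normalise : ∀ {s t c} m → Nonneg m → (∀ a b → m a b ≤ c a b) → (∀ u → u ≢ s → u ≢ t → inAt m u ≡ outAt m u) →
              inAt m s ≡ 0# → 1# ≤ outAt m s → Σ Capacities (IsUnitFlowWithin s t c)
  normalise {s} {t} {c} m m≥0 m≤c conserved into-s≡0 1≤out-s =
    (λ a b → m a b * k) , (λ a b → *-nonneg (m≥0 a b) 0≤k) , h≤c , h-conserved , h-value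
    where
    v≢0 : outAt m s ≢ 0#
    v≢0 v≡0 = 1≰0 (subst (1# ≤_) v≡0 1≤out-s)
    k : Carrier
    k = inverse (outAt m s) v≢0
    0≤k : 0# ≤ k
    0≤k = inverse-nonneg v≢0 (≤-trans 0≤1 1≤out-s)
    h≤c : ∀ a b → m a b * k ≤ c a b
    h≤c a b = ≤-trans (subst (m a b * k ≤_) (*-identityʳ (m a b)) (*-monoˡ-≤ (m≥0 a b) (inverse≤1 v≢0 1≤out-s))) (m≤c a b)
    h-conserved : ∀ u → u ≢ s → u ≢ t → ∑[ a ∈ vs ] (m a u * k) ≡ ∑[ b ∈ vs ] (m u b * k)
    h-conserved u u≢s u≢t = trans (sum-*ʳ vs (λ a → m a u) k) (trans (cong (_* k) (conserved u u≢s u≢t)) (sym (sum-*ʳ vs (m u) k)))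
    h-value : ∑[ b ∈ vs ] (m s b * k) - ∑[ a ∈ vs ] (m a s * k) ≡ 1#
    h-value = begin
      ∑[ b ∈ vs ] (m s b * k) - ∑[ a ∈ vs ] (m a s * k) ≡⟨ cong₂ _-_ (sum-*ʳ vs (m s) k) (sum-*ʳ vs (λ a → m a s) k) ⟩
      outAt m s * k - inAt m s * k                       ≡⟨ cong (λ z → outAt m s * k - z * k) into-s≡0 ⟩
      outAt m s * k - 0# * k                             ≡⟨ cong (λ z → outAt m s * k - z) (zeroˡ k) ⟩
      outAt m s * k - 0#                                 ≡⟨ x-0≡x _ ⟩
      outAt m s * k                                      ≡⟨ inverse-inv (outAt m s) v≢0 ⟩
      1#                                                 ∎

  -- Max-flow min-cut: lowering every arc as far as the cut condition allows leaves only tight arcs, and then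
  -- the capacities themselves are conserved; normalising by the outflow of s gives value 1.
  unitFlow : ∀ {s t} → s ≢ t → ∀ c → Nonneg c → CutCondition s t c → Σ Capacities (IsUnitFlowWithin s t c)
  unitFlow {s} {t} s≢t c c≥0 cut≥1 =
    normalise m m≥0 (lowerAll≤ s t arcs (c≥0 , cut≥1)) conserved inAt-source≡0 (1≤outAt-source (s≢t ∘ sym))
    where
    arcs : List (V × V)
    arcs = cartesianProduct vs vs
    m : Capacities
    m = lowerAll s t arcs c
    m≥0 : Nonneg m
    m≥0 = proj₁ (lowerAll-admissible s t arcs (c≥0 , cut≥1))
    m-cut≥1 : CutCondition s t m
    m-cut≥1 = proj₂ (lowerAll-admissible s t arcs (c≥0 , cut≥1))
    m-tight : ∀ a b → TightArc s t m a b
    m-tight a b = lowerAll-tight s t arcs (c≥0 , cut≥1) (∈-cartesianProduct⁺ (∈vs a) (∈vs b))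
    open Conservation s t m m≥0 m-cut≥1 m-tight
    -- Conservation applied to the reversed network bounds inflow by outflow.
    module Reversed = Conservation t s (transpose m) (λ a b → m≥0 b a) (transpose-cutCondition m-cut≥1)
                                   (λ a b → transpose-tight (m-tight b a))
    conserved : ∀ u → u ≢ s → u ≢ t → inAt m u ≡ outAt m u
    conserved u u≢s u≢t = antisym (Reversed.out≤in u u≢t u≢s) (out≤in u u≢s u≢t)

allSubsets-complete : ∀ n (Z : Subset n) → Z ∈ allSubsets n
allSubsets-complete zero    []          = here refl
allSubsets-complete (suc n) (true ∷ Z)  = ∈-++⁺ˡ (∈-map⁺ (true ∷_) (allSubsets-complete n Z))
allSubsets-complete (suc n) (false ∷ Z) =
  ∈-++⁺ʳ (map (true ∷_) (allSubsets n)) (∈-map⁺ (false ∷_) (allSubsets-complete n Z))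

allSubsets-unique : ∀ n → Unique (allSubsets n)
allSubsets-unique zero    = [] ∷ []
allSubsets-unique (suc n) = ++⁺ (map⁺ ∷-injectiveʳ (allSubsets-unique n)) (map⁺ ∷-injectiveʳ (allSubsets-unique n)) heads-differ
  where
  heads-differ : ∀ {Z} → ¬ (Z ∈ map (true ∷_) (allSubsets n) × Z ∈ map (false ∷_) (allSubsets n))
  heads-differ (Z∈₁ , Z∈₂) with ∈-map⁻ (true ∷_) Z∈₁ | ∈-map⁻ (false ∷_) Z∈₂
  ... | _ , _ , refl | _ , _ , ()

eqᵇ-refl : ∀ {n} (Z : Subset n) → eqᵇ Z Z ≡ true
eqᵇ-refl Z with ≡-dec _≟ᵇ_ Z Z
... | yes _   = refl
... | no Z≢Z = ⊥-elim (Z≢Z refl)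

eqᵇ⇒≡ : ∀ {n} {Z W : Subset n} → eqᵇ Z W ≡ true → Z ≡ W
eqᵇ⇒≡ {Z = Z} {W} Z=W with ≡-dec _≟ᵇ_ Z W
... | yes Z≡W = Z≡W

eqᵇ-sym : ∀ {n} (Z W : Subset n) → eqᵇ Z W ≡ eqᵇ W Z
eqᵇ-sym Z W with ≡-dec _≟ᵇ_ Z W | ≡-dec _≟ᵇ_ W Z
... | yes _   | yes _   = refl
... | no  _   | no  _   = refl
... | yes Z≡W | no  W≢Z = ⊥-elim (W≢Z (sym Z≡W))
... | no  Z≢W | yes W≡Z = ⊥-elim (Z≢W (sym W≡Z))

⊥ᵇ-sym : ∀ {n} (I J : Subset n) → ⊥ᵇ I J ≡ ⊥ᵇ J I
⊥ᵇ-sym I J = ∧-comm (not (does (I ⊆? J))) _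

⊥ᵇ-irrefl : ∀ {n} (Z : Subset n) → ⊥ᵇ Z Z ≡ false
⊥ᵇ-irrefl Z with Z ⊆? Z
... | yes _   = refl
... | no Z⊈Z = ⊥-elim (Z⊈Z ⊆-refl)

⊂ᵇ⇒⊂ : ∀ {n} {X Y : Subset n} → ⊂ᵇ X Y ≡ true → X ⊂ Y
⊂ᵇ⇒⊂ {X = X} {Y} X⊂ᵇY with X ⊂? Y
... | yes X⊂Y = X⊂Y

∣Z∣≤0⇒Z≡∅ : ∀ {n} (Z : Subset n) → ∣ Z ∣ ≤ℕ 0 → Z ≡ ∅
∣Z∣≤0⇒Z≡∅ []          _      = refl
∣Z∣≤0⇒Z≡∅ (false ∷ Z) ∣Z∣≤0 = cong (false ∷_) (∣Z∣≤0⇒Z≡∅ Z ∣Z∣≤0)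

≡∅⊎≡⁅⁆ : ∀ {n} (Z : Subset n) → ∣ Z ∣ ≤ℕ 1 → (Z ≡ ∅) ⊎ Σ (Fin n) λ j → Z ≡ ⁅ j ⁆
≡∅⊎≡⁅⁆ []          _           = inj₁ refl
≡∅⊎≡⁅⁆ (true ∷ Z)  (s≤s ∣Z∣≤0) = inj₂ (fzero , cong (true ∷_) (∣Z∣≤0⇒Z≡∅ Z ∣Z∣≤0))
≡∅⊎≡⁅⁆ (false ∷ Z) ∣Z∣≤1 with ≡∅⊎≡⁅⁆ Z ∣Z∣≤1
... | inj₁ Z≡∅       = inj₁ (cong (false ∷_) Z≡∅)
... | inj₂ (j , Z≡j) = inj₂ (fsuc j , cong (false ∷_) Z≡j)

⁅j⁆⊂ᵇZ : ∀ {n} {j : Fin n} {Z} → j ∈ₛ Z → Z ≢ ⁅ j ⁆ → ⊂ᵇ ⁅ j ⁆ Z ≡ true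
⁅j⁆⊂ᵇZ {j = j} {Z} j∈Z Z≢⁅j⁆ with ⁅ j ⁆ ⊂? Z
... | yes _      = refl
... | no ⁅j⁆⊄Z = ⊥-elim (Z≢⁅j⁆ (⊆-antisym Z⊆⁅j⁆ ⁅j⁆⊆Z))
  where
  ⁅j⁆⊆Z : ⁅ j ⁆ ⊆ Z
  ⁅j⁆⊆Z x∈⁅j⁆ = subst (_∈ₛ Z) (sym (x∈⁅y⁆⇒x≡y j x∈⁅j⁆)) j∈Z
  Z⊆⁅j⁆ : Z ⊆ ⁅ j ⁆
  Z⊆⁅j⁆ {x} x∈Z with x ∈? ⁅ j ⁆
  ... | yes x∈⁅j⁆ = x∈⁅j⁆
  ... | no  x∉⁅j⁆ = ⊥-elim (⁅j⁆⊄Z (⁅j⁆⊆Z , x , x∈Z , x∉⁅j⁆))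

any-∈ : ∀ {A : Set} (p : A → Bool) {x xs} → x ∈ xs → p x ≡ true → any p xs ≡ true
any-∈ p {xs = _ ∷ ys} (here refl) px = cong (_∨ any p ys) px
any-∈ p {xs = y ∷ _} (there x∈) px = trans (cong (p y ∨_) (any-∈ p x∈ px)) (∨-zeroʳ (p y))

-- Uncrossing the dual program D

jumpWeight : (F : OrderedField) {n k : ℕ} → SimpleInstance (OrderedField.Carrier F) n k →
             (Fin k → OrderedField.Carrier F) → Subset n → OrderedField.Carrier F
jumpWeight F {k = k} inst δ R = ∑[ i ∈ allFin k ] [ does (X i ⊆? R) ∧ not (does (Y i ⊆? R)) ]· δ i
  where open Summation F
        open SimpleInstance inst

module Uncrossing (F : OrderedField) {n k : ℕ} (inst : SimpleInstance (OrderedField.Carrier F) n k)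
                  (δ : Fin k → OrderedField.Carrier F) (σ μ : Subset n → Subset n → OrderedField.Carrier F)
                  (feasible : FeasibleD F inst δ σ μ) (R : Subset n) {t : Fin n} (t∉R : t ∉ₛ R) where
  open OrderedField F
  open Arithmetic F
  open Summation F
  open SimpleInstance inst
  open ≡-Reasoning

  private
    subsets : List (Subset n)
    subsets = allSubsets n
    pairs : List (Subset n × Subset n)
    pairs = upairs subsets
    constraints : List (Fin k)
    constraints = allFin k
    σ≥0 : ∀ I J → 0# ≤ σ I J
    σ≥0 = proj₁ (proj₂ feasible)
    σ-sym : ∀ I J → σ I J ≡ σ J I
    σ-sym = proj₁ (proj₂ (proj₂ feasible))
    μ≥0 : ∀ X′ Y′ → 0# ≤ μ X′ Y′
    μ≥0 = proj₁ (proj₂ (proj₂ (proj₂ feasible)))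
    excess-full : 1# ≤ excess F inst δ σ μ full
    excess-full = proj₁ (proj₂ (proj₂ (proj₂ (proj₂ feasible))))
    excess-proper : ∀ Z → Z ≢ ∅ → Z ≢ full → 0# ≤ excess F inst δ σ μ Z
    excess-proper = proj₂ (proj₂ (proj₂ (proj₂ (proj₂ (proj₂ feasible)))))

  leaves : Subset n → Bool
  leaves Z = not (does (Z ⊆? R))

  leaves-true : ∀ {Z} → ¬ Z ⊆ R → leaves Z ≡ true
  leaves-true {Z} Z⊈R with Z ⊆? R
  ... | yes Z⊆R = ⊥-elim (Z⊈R Z⊆R)
  ... | no  _   = refl

  leaves-false : ∀ {Z} → Z ⊆ R → leaves Z ≡ false
  leaves-false {Z} Z⊆R with Z ⊆? R
  ... | yes _   = refl
  ... | no Z⊈R = ⊥-elim (Z⊈R Z⊆R)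

  leaves-mono : ∀ {Y Z} → Y ⊆ Z → leaves Y ≡ true → leaves Z ≡ true
  leaves-mono {Y} {Z} Y⊆Z Y-leaves with Z ⊆? R
  ... | no  _   = refl
  ... | yes Z⊆R = case trans (sym Y-leaves) (leaves-false (⊆-trans Y⊆Z Z⊆R)) of λ ()

  leaves-submodular : ∀ I J {x} → 0# ≤ x → [ leaves (I ∩ J) ]· x + [ leaves (I ∪ J) ]· x ≤ [ leaves I ]· x + [ leaves J ]· x
  leaves-submodular I J = []·-exchange ∨⇒∨ ∧⇒∧
    where
    ∧⇒∧ : (leaves (I ∩ J) ∧ leaves (I ∪ J)) ≡ true → (leaves I ∧ leaves J) ≡ true
    ∧⇒∧ both = let ∩-leaves = proj₁ (∧-true⁻ both) in
      cong₂ _∧_ (leaves-mono (p∩q⊆p I J) ∩-leaves) (leaves-mono (p∩q⊆q I J) ∩-leaves)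
    ∨⇒∨ : (leaves (I ∩ J) ∨ leaves (I ∪ J)) ≡ true → (leaves I ∨ leaves J) ≡ true
    ∨⇒∨ either with I ⊆? R | J ⊆? R
    ... | no _    | _       = refl
    ... | yes _   | no _    = refl
    ... | yes I⊆R | yes J⊆R =
      case trans (sym either) (cong₂ _∨_ (leaves-false (⊆-trans (p∩q⊆p I J) I⊆R)) (leaves-false ∪⊆R)) of λ ()
      where
      ∪⊆R : I ∪ J ⊆ R
      ∪⊆R x∈ with x∈p∪q⁻ I J x∈
      ... | inj₁ x∈I = I⊆R x∈I
      ... | inj₂ x∈J = J⊆R x∈J

  leavingSum : (Subset n → Carrier) → Carrier
  leavingSum f = ∑[ Z ∈ subsets ] [ leaves Z ]· f Z

  leavingSum-cong : ∀ {f g} → (∀ Z → f Z ≡ g Z) → leavingSum f ≡ leavingSum g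
  leavingSum-cong f≗g = sum-cong subsets λ Z → cong ([ leaves Z ]·_) (f≗g Z)

  leavingSum-+ : ∀ f g → leavingSum (λ Z → f Z + g Z) ≡ leavingSum f + leavingSum g
  leavingSum-+ f g = trans (sum-cong subsets λ Z → []·-distrib-+ (leaves Z) (f Z) (g Z)) (sum-distrib-+ subsets _ _)

  leavingSum-- : ∀ f g → leavingSum (λ Z → f Z - g Z) ≡ leavingSum f - leavingSum g
  leavingSum-- f g = trans (sum-cong subsets λ Z → []·-distrib-- (leaves Z) (f Z) (g Z)) (sum-distrib-- subsets _ _)

  leavingSum-fibres : ∀ {A : Set} (xs : List A) (p : A → Bool) (g : A → Subset n) (f : A → Carrier) →
                      leavingSum (λ Z → ∑[ a ∈ xs ] [ p a ∧ eqᵇ Z (g a) ]· f a) ≡ ∑[ a ∈ xs ] [ p a ]· [ leaves (g a) ]· f a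
  leavingSum-fibres xs p g f = begin
    ∑[ Z ∈ subsets ] [ leaves Z ]· ∑[ a ∈ xs ] [ p a ∧ eqᵇ Z (g a) ]· f a
      ≡⟨ sum-cong subsets (λ Z → sym (sum-[]· xs (leaves Z) _)) ⟩
    ∑[ Z ∈ subsets ] ∑[ a ∈ xs ] [ leaves Z ]· [ p a ∧ eqᵇ Z (g a) ]· f a
      ≡⟨ sum-comm subsets xs _ ⟩
    ∑[ a ∈ xs ] ∑[ Z ∈ subsets ] [ leaves Z ]· [ p a ∧ eqᵇ Z (g a) ]· f a
      ≡⟨ sum-cong xs (λ a → sum-cong subsets λ Z → shuffle (leaves Z) (p a) (eqᵇ Z (g a)) (f a)) ⟩
    ∑[ a ∈ xs ] ∑[ Z ∈ subsets ] [ eqᵇ Z (g a) ]· [ p a ]· [ leaves Z ]· f a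
      ≡⟨ sum-cong xs (λ a → sum-select (≡-dec _≟ᵇ_) (allSubsets-unique n) (allSubsets-complete n (g a))
                                          (λ Z → [ p a ]· [ leaves Z ]· f a)) ⟩
    ∑[ a ∈ xs ] [ p a ]· [ leaves (g a) ]· f a ∎
    where
    shuffle : ∀ w q e x → [ w ]· [ q ∧ e ]· x ≡ [ e ]· [ q ]· [ w ]· x
    shuffle w     true  e     x = []·-comm w e x
    shuffle true  false true  x = refl
    shuffle true  false false x = refl
    shuffle false false true  x = refl
    shuffle false false false x = refl

  δ-into δ-outof σ-meet σ-join σ-split μ-below μ-above : Subset n → Carrier
  δ-into  Z = sumIf F constraints (λ i → eqᵇ Z (Y i)) δ
  δ-outof Z = sumIf F constraints (λ i → eqᵇ Z (X i)) δ
  σ-meet  Z = sumIf F pairs (λ (I , J) → ⊥ᵇ I J ∧ eqᵇ (I ∩ J) Z) (λ (I , J) → σ I J)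
  σ-join  Z = sumIf F pairs (λ (I , J) → ⊥ᵇ I J ∧ eqᵇ (I ∪ J) Z) (λ (I , J) → σ I J)
  σ-split Z = sumIf F subsets (λ J → ⊥ᵇ J Z) (λ J → σ Z J)
  μ-below Z = sumIf F subsets (λ X′ → ⊂ᵇ X′ Z) (λ X′ → μ X′ Z)
  μ-above Z = sumIf F subsets (λ Y′ → ⊂ᵇ Z Y′) (λ Y′ → μ Z Y′)

  leavingSum-excess : leavingSum (excess F inst δ σ μ) ≡
    (((((leavingSum δ-into - leavingSum δ-outof) + leavingSum σ-meet) + leavingSum σ-join)
      - leavingSum σ-split) - leavingSum μ-below) + leavingSum μ-above
  leavingSum-excess =
    trans (leavingSum-+ _ μ-above) (cong (_+ leavingSum μ-above)
    (trans (leavingSum-- _ μ-below) (cong (λ z → z - leavingSum μ-below)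
    (trans (leavingSum-- _ σ-split) (cong (λ z → z - leavingSum σ-split)
    (trans (leavingSum-+ _ σ-join) (cong (_+ leavingSum σ-join)
    (trans (leavingSum-+ _ σ-meet) (cong (_+ leavingSum σ-meet)
    (leavingSum-- δ-into δ-outof))))))))))

  leavingSum-δ : ∀ (g : Fin k → Subset n) →
                 leavingSum (λ Z → sumIf F constraints (λ i → eqᵇ Z (g i)) δ) ≡ ∑[ i ∈ constraints ] [ leaves (g i) ]· δ i
  leavingSum-δ g = trans (leavingSum-cong λ Z → sumIf≡∑ constraints _ δ) (leavingSum-fibres constraints (λ _ → true) g δ)

  δ-bound : leavingSum δ-into - leavingSum δ-outof ≤ jumpWeight F inst δ R
  δ-bound = subst (_≤ jumpWeight F inst δ R) (trans (sum-distrib-- constraints _ _) (sym (cong₂ _-_ (leavingSum-δ Y) (leavingSum-δ X))))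
                  (sum-mono-≤ constraints pointwise)
    where
    pointwise : ∀ i → [ leaves (Y i) ]· δ i - [ leaves (X i) ]· δ i ≤ [ does (X i ⊆? R) ∧ leaves (Y i) ]· δ i
    pointwise i with X i ⊆? R | Y i ⊆? R
    ... | yes _   | yes _   = ≤-reflexive (-‿inverseʳ 0#)
    ... | yes _   | no  _   = ≤-reflexive (x-0≡x (δ i))
    ... | no X⊈R  | yes Y⊆R = ⊥-elim (X⊈R (⊆-trans (p⊂q⇒p⊆q (X⊂Y i)) Y⊆R))
    ... | no  _   | no  _   = ≤-reflexive (-‿inverseʳ (δ i))

  leavingSum-σ-pairs : ∀ (op : Subset n → Subset n → Subset n) →
    leavingSum (λ Z → sumIf F pairs (λ (I , J) → ⊥ᵇ I J ∧ eqᵇ (op I J) Z) (λ (I , J) → σ I J))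
    ≡ sum pairs λ (I , J) → [ ⊥ᵇ I J ]· [ leaves (op I J) ]· σ I J
  leavingSum-σ-pairs op =
    trans (leavingSum-cong λ Z → trans (sumIf≡∑ pairs _ _) (sum-cong pairs λ (I , J) →
            cong (λ b → [ ⊥ᵇ I J ∧ b ]· σ I J) (eqᵇ-sym (op I J) Z)))
          (leavingSum-fibres pairs (λ (I , J) → ⊥ᵇ I J) (λ (I , J) → op I J) (λ (I , J) → σ I J))

  leavingSum-σ-split : leavingSum σ-split ≡ sum pairs λ (I , J) → [ ⊥ᵇ I J ]· ([ leaves I ]· σ I J + [ leaves J ]· σ I J)
  leavingSum-σ-split = begin
    ∑[ Z ∈ subsets ] [ leaves Z ]· σ-split Z
      ≡⟨ sum-cong subsets (λ Z → trans (cong ([ leaves Z ]·_) (sumIf≡∑ subsets _ _)) (sym (sum-[]· subsets (leaves Z) _))) ⟩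
    ∑[ Z ∈ subsets ] ∑[ J ∈ subsets ] G Z J
      ≡⟨ sum-upairs subsets G ⟩
    (sum pairs λ (I , J) → G I J + G J I) + ∑[ Z ∈ subsets ] G Z Z
      ≡⟨ cong ((sum pairs λ (I , J) → G I J + G J I) +_) (trans (sum-cong subsets diagonal) (sum-zero subsets)) ⟩
    (sum pairs λ (I , J) → G I J + G J I) + 0#
      ≡⟨ +-identityʳ _ ⟩
    (sum pairs λ (I , J) → G I J + G J I)
      ≡⟨ sum-cong pairs pair ⟩
    (sum pairs λ (I , J) → [ ⊥ᵇ I J ]· ([ leaves I ]· σ I J + [ leaves J ]· σ I J)) ∎
    where
    G : Subset n → Subset n → Carrier
    G Z J = [ leaves Z ]· [ ⊥ᵇ J Z ]· σ Z J
    diagonal : ∀ Z → G Z Z ≡ 0#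
    diagonal Z rewrite ⊥ᵇ-irrefl Z = []·-zero (leaves Z)
    pair : ∀ ((I , J) : Subset n × Subset n) → G I J + G J I ≡ [ ⊥ᵇ I J ]· ([ leaves I ]· σ I J + [ leaves J ]· σ I J)
    pair (I , J) rewrite ⊥ᵇ-sym J I | σ-sym J I =
      trans (cong₂ _+_ ([]·-comm (leaves I) (⊥ᵇ I J) (σ I J)) ([]·-comm (leaves J) (⊥ᵇ I J) (σ I J)))
            (sym ([]·-distrib-+ (⊥ᵇ I J) ([ leaves I ]· σ I J) ([ leaves J ]· σ I J)))

  σ-bound : leavingSum σ-meet + leavingSum σ-join ≤ leavingSum σ-split
  σ-bound = subst₂ _≤_ split-meet-join (sym leavingSum-σ-split)
                       (sum-mono-≤ pairs λ (I , J) → []·-monoʳ-≤ (⊥ᵇ I J) (leaves-submodular I J (σ≥0 I J)))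
    where
    split-meet-join : (sum pairs λ (I , J) → [ ⊥ᵇ I J ]· ([ leaves (I ∩ J) ]· σ I J + [ leaves (I ∪ J) ]· σ I J))
                      ≡ leavingSum σ-meet + leavingSum σ-join
    split-meet-join =
      trans (sum-cong pairs λ (I , J) → []·-distrib-+ (⊥ᵇ I J) ([ leaves (I ∩ J) ]· σ I J) ([ leaves (I ∪ J) ]· σ I J))
            (trans (sum-distrib-+ pairs (λ (I , J) → [ ⊥ᵇ I J ]· [ leaves (I ∩ J) ]· σ I J)
                                        (λ (I , J) → [ ⊥ᵇ I J ]· [ leaves (I ∪ J) ]· σ I J))
                   (sym (cong₂ _+_ (leavingSum-σ-pairs _∩_) (leavingSum-σ-pairs _∪_))))

  μ-bound : leavingSum μ-above ≤ leavingSum μ-below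
  μ-bound = subst₂ _≤_ (sym above) (sym below) (sum-mono-≤ subsets λ X′ → sum-mono-≤ subsets λ Y′ → pointwise X′ Y′)
    where
    above : leavingSum μ-above ≡ ∑[ X′ ∈ subsets ] ∑[ Y′ ∈ subsets ] [ leaves X′ ]· [ ⊂ᵇ X′ Y′ ]· μ X′ Y′
    above = sum-cong subsets λ X′ → trans (cong ([ leaves X′ ]·_) (sumIf≡∑ subsets _ _)) (sym (sum-[]· subsets (leaves X′) _))
    below : leavingSum μ-below ≡ ∑[ X′ ∈ subsets ] ∑[ Y′ ∈ subsets ] [ leaves Y′ ]· [ ⊂ᵇ X′ Y′ ]· μ X′ Y′
    below = trans (sum-cong subsets λ Y′ → trans (cong ([ leaves Y′ ]·_) (sumIf≡∑ subsets _ _))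
                                                 (sym (sum-[]· subsets (leaves Y′) _)))
                  (sum-comm subsets subsets _)
    pointwise : ∀ X′ Y′ → [ leaves X′ ]· [ ⊂ᵇ X′ Y′ ]· μ X′ Y′ ≤ [ leaves Y′ ]· [ ⊂ᵇ X′ Y′ ]· μ X′ Y′
    pointwise X′ Y′ with ⊂ᵇ X′ Y′ in X′⊂Y′
    ... | true  = []·-monoˡ-≤ (leaves-mono {X′} {Y′} (p⊂q⇒p⊆q (⊂ᵇ⇒⊂ {X = X′} {Y′} X′⊂Y′))) (μ≥0 X′ Y′)
    ... | false = ≤-reflexive (trans ([]·-zero (leaves X′)) (sym ([]·-zero (leaves Y′))))

  -- ∅ ⊆ R never leaves R.
  1≤leavingSum-excess : 1# ≤ leavingSum (excess F inst δ σ μ)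
  1≤leavingSum-excess =
    ≤-trans (subst (λ b → 1# ≤ [ b ]· excess F inst δ σ μ full) (sym full-leaves) excess-full)
            (∈⇒≤sum subsets term≥0 (allSubsets-complete n full))
    where
    full-leaves : leaves full ≡ true
    full-leaves = leaves-true (λ full⊆R → t∉R (full⊆R ∈⊤))
    term≥0 : ∀ Z → 0# ≤ [ leaves Z ]· excess F inst δ σ μ Z
    term≥0 Z with leaves Z in Z-leaves | ≡-dec _≟ᵇ_ Z full | ≡-dec _≟ᵇ_ Z ∅
    ... | false | _        | _        = ≤-refl
    ... | true  | yes refl | _        = ≤-trans 0≤1 excess-full
    ... | true  | no _     | yes refl = case trans (sym Z-leaves) (leaves-false ⊥⊆) of λ ()
    ... | true  | no Z≢full | no Z≢∅  = excess-proper Z Z≢∅ Z≢full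

  jumpWeight≥1 : 1# ≤ jumpWeight F inst δ R
  jumpWeight≥1 = ≤-trans 1≤leavingSum-excess
                         (subst (_≤ jumpWeight F inst δ R) (sym leavingSum-excess) (regroup δ-bound σ-bound μ-bound))
    where
    open CommutativeMonoidSolver +-commutativeMonoid using (solve; _⊕_; _⊜_)
    regroup : ∀ {a b c d e f g T} → a - b ≤ T → c + d ≤ e → g ≤ f → (((((a - b) + c) + d) - e) - f) + g ≤ T
    regroup {a} {b} {c} {d} {e} {f} {g} {T} a-b≤T c+d≤e g≤f =
      subst₂ _≤_ (sym regrouped) (+-identityʳ T)
        (+-mono-≤ a-b≤T (subst (((c + d) - e) + (g - f) ≤_) (+-identityʳ 0#)
                               (+-mono-≤ (x≤y⇒x-y≤0 c+d≤e) (x≤y⇒x-y≤0 g≤f))))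
      where
      regrouped : (((((a - b) + c) + d) - e) - f) + g ≡ (a - b) + (((c + d) - e) + (g - f))
      regrouped = solve 7 (λ a nb c d ne nf g → (((((a ⊕ nb) ⊕ c) ⊕ d) ⊕ ne) ⊕ nf) ⊕ g
                                                ⊜ (a ⊕ nb) ⊕ (((c ⊕ d) ⊕ ne) ⊕ (g ⊕ nf)))
                        refl a (- b) c d (- e) (- f) g

-- The network G_δ

module Network (F : OrderedField) {n k : ℕ} (inst : SimpleInstance (OrderedField.Carrier F) n k)
               (δ : Fin k → OrderedField.Carrier F) (δ≥0 : ∀ i → OrderedField._≤ᶠ_ F (OrderedField.0# F) (δ i)) where
  open OrderedField F
  open Arithmetic F
  open Summation F
  open SimpleInstance inst

  private
    subsets : List (Subset n)
    subsets = allSubsets n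
    constraints : List (Fin k)
    constraints = allFin k

  isVertex : Subset n → Bool
  isVertex = isVertexᵇ F inst

  -- The infinite-capacity arcs A → B of G_δ; B is a vertex automatically, as |B| ≤ 1.
  downArc : Subset n → Subset n → Bool
  downArc A B = isVertex A ∧ ⊂ᵇ B A ∧ atMostOneᵇ B

  isVertex-∅ : isVertex ∅ ≡ true
  isVertex-∅ = cong (_∨ (does (∣ ∅ {n} ∣ ≟ℕ 1) ∨ any (λ i → eqᵇ ∅ (Y i)) constraints)) (eqᵇ-refl (∅ {n}))

  isVertex-⁅⁆ : ∀ (j : Fin n) → isVertex ⁅ j ⁆ ≡ true
  isVertex-⁅⁆ j = trans (cong (λ m → eqᵇ ⁅ j ⁆ ∅ ∨ (does (m ≟ℕ 1) ∨ any (λ i → eqᵇ ⁅ j ⁆ (Y i)) constraints)) (∣⁅x⁆∣≡1 j))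
                        (∨-zeroʳ _)

  isVertex-Y : ∀ i → isVertex (Y i) ≡ true
  isVertex-Y i = trans (cong (λ b → eqᵇ (Y i) ∅ ∨ (does (∣ Y i ∣ ≟ℕ 1) ∨ b))
                             (any-∈ (λ j → eqᵇ (Y i) (Y j)) (∈-allFin i) (eqᵇ-refl (Y i))))
                       (trans (cong (eqᵇ (Y i) ∅ ∨_) (∨-zeroʳ _)) (∨-zeroʳ _))

  atMostOne-⁅⁆ : ∀ (j : Fin n) → atMostOneᵇ ⁅ j ⁆ ≡ true
  atMostOne-⁅⁆ j = cong (_≤ᵇ 1) (∣⁅x⁆∣≡1 j)

  atMostOne⇒isVertex : ∀ {B} → atMostOneᵇ B ≡ true → isVertex B ≡ true
  atMostOne⇒isVertex {B} amo with ≡∅⊎≡⁅⁆ B (≤ᵇ⇒≤ ∣ B ∣ 1 (subst T (sym amo) tt))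
  ... | inj₁ refl       = isVertex-∅
  ... | inj₂ (j , refl) = isVertex-⁅⁆ j

  Node : Set
  Node = Subset n ⊎ Fin k

  _≟ₙ_ : DecidableEquality Node
  _≟ₙ_ = ≡-dec-⊎ (≡-dec _≟ᵇ_) _≟ᶠ_

  nodes : List Node
  nodes = map inj₁ subsets ++ map inj₂ constraints

  ∈nodes : ∀ v → v ∈ nodes
  ∈nodes (inj₁ Z) = ∈-++⁺ˡ (∈-map⁺ inj₁ (allSubsets-complete n Z))
  ∈nodes (inj₂ i) = ∈-++⁺ʳ (map inj₁ subsets) (∈-map⁺ inj₂ (∈-allFin i))

  nodes-unique : Unique nodes
  nodes-unique = ++⁺ (map⁺ inj₁-injective (allSubsets-unique n)) (map⁺ inj₂-injective (allFin⁺ k)) sides-differ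
    where
    sides-differ : ∀ {v} → ¬ (v ∈ map inj₁ subsets × v ∈ map inj₂ constraints)
    sides-differ (v∈₁ , v∈₂) with ∈-map⁻ inj₁ v∈₁ | ∈-map⁻ inj₂ v∈₂
    ... | _ , _ , refl | _ , _ , ()

  sum-nodes : ∀ f → sum nodes f ≡ ∑[ A ∈ subsets ] f (inj₁ A) + ∑[ i ∈ constraints ] f (inj₂ i)
  sum-nodes f = trans (sum-++ (map inj₁ subsets) (map inj₂ constraints) f)
                      (cong₂ _+_ (sum-map subsets inj₁ f) (sum-map constraints inj₂ f))

  select-subset : ∀ Z (q : Subset n → Carrier) → ∑[ A ∈ subsets ] [ eqᵇ A Z ]· q A ≡ q Z
  select-subset Z = sum-select (≡-dec _≟ᵇ_) (allSubsets-unique n) (allSubsets-complete n Z)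

  -- Each arc X_i → Y_i of G_δ is routed through a node of its own, so that constraints with equal
  -- (X_i, Y_i) keep separate arcs; infinite capacities are replaced by 1, which suffices for a unit flow.
  capacity : Node → Node → Carrier
  capacity (inj₁ A) (inj₁ B) = [ downArc A B ]· 1#
  capacity (inj₁ A) (inj₂ i) = [ eqᵇ A (X i) ]· δ i
  capacity (inj₂ i) (inj₁ B) = [ eqᵇ B (Y i) ]· 1#
  capacity (inj₂ i) (inj₂ j) = 0#

  open CutFlow F _≟ₙ_ nodes ∈nodes nodes-unique

  capacity-nonneg : Nonneg capacity
  capacity-nonneg (inj₁ A) (inj₁ B) = []·-nonneg (downArc A B) 0≤1
  capacity-nonneg (inj₁ A) (inj₂ i) = []·-nonneg (eqᵇ A (X i)) (δ≥0 i)
  capacity-nonneg (inj₂ i) (inj₁ B) = []·-nonneg (eqᵇ B (Y i)) 0≤1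
  capacity-nonneg (inj₂ i) (inj₂ j) = ≤-refl

  unitArc : Node → Node → Bool
  unitArc (inj₁ A) (inj₁ B) = downArc A B
  unitArc (inj₂ i) (inj₁ B) = eqᵇ B (Y i)
  unitArc _        _        = false

  unitArc⇒capacity≡1 : ∀ a b → unitArc a b ≡ true → capacity a b ≡ 1#
  unitArc⇒capacity≡1 (inj₁ A) (inj₁ B) arc = cong ([_]· 1#) arc
  unitArc⇒capacity≡1 (inj₂ i) (inj₁ B) arc = cong ([_]· 1#) arc

  source : Node
  source = inj₁ ∅

  sink : Fin n → Node
  sink t = inj₁ ⁅ t ⁆

  δ-arcs≤cap : ∀ S → ∑[ i ∈ constraints ] [ S (inj₁ (X i)) ∧ not (S (inj₂ i)) ]· δ i ≤ cap capacity S
  δ-arcs≤cap S = begin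
    ∑[ i ∈ constraints ] [ S (inj₁ (X i)) ∧ not (S (inj₂ i)) ]· δ i
      ≡⟨ sum-cong constraints (λ i → select-subset (X i) (λ A → [ S (inj₁ A) ∧ not (S (inj₂ i)) ]· δ i)) ⟨
    ∑[ i ∈ constraints ] ∑[ A ∈ subsets ] [ eqᵇ A (X i) ]· [ S (inj₁ A) ∧ not (S (inj₂ i)) ]· δ i
      ≡⟨ sum-cong constraints (λ i → sum-cong subsets λ A → []·-comm (eqᵇ A (X i)) _ (δ i)) ⟩
    ∑[ i ∈ constraints ] ∑[ A ∈ subsets ] term (inj₁ A) (inj₂ i)
      ≡⟨ sum-comm constraints subsets _ ⟩
    ∑[ A ∈ subsets ] ∑[ i ∈ constraints ] term (inj₁ A) (inj₂ i)
      ≤⟨ sum-mono-≤ subsets (λ A → subst (∑[ i ∈ constraints ] term (inj₁ A) (inj₂ i) ≤_) (sym (sum-nodes (term (inj₁ A))))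
                                         (y≤x+y (sum-nonneg subsets λ B → term≥0 (inj₁ A) (inj₁ B)))) ⟩
    ∑[ A ∈ subsets ] sum nodes (term (inj₁ A))
      ≤⟨ subst (∑[ A ∈ subsets ] sum nodes (term (inj₁ A)) ≤_) (sym (sum-nodes (λ a → sum nodes (term a))))
               (x≤x+y (sum-nonneg constraints λ i → sum-nonneg nodes (term≥0 (inj₂ i)))) ⟩
    cap capacity S ∎
    where
    open ≤-Reasoning
    term : Node → Node → Carrier
    term a b = [ S a ∧ not (S b) ]· capacity a b
    term≥0 : ∀ a b → 0# ≤ term a b
    term≥0 a b = []·-nonneg (S a ∧ not (S b)) (capacity-nonneg a b)

  -- A cut containing ∅ and closed under the unit arcs is controlled by R = {j | {j} ∈ S}.
  module ClosedCut (S : Cut) (S∅ : S source ≡ true)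
                   (closed : ∀ a b → S a ≡ true → unitArc a b ≡ true → S b ≡ true) where

    R : Subset n
    R = tabulate (λ j → S (inj₁ ⁅ j ⁆))

    ∈R⁺ : ∀ {j} → S (inj₁ ⁅ j ⁆) ≡ true → j ∈ₛ R
    ∈R⁺ {j} S⁅j⁆ = lookup⇒[]= j R (trans (lookup∘tabulate _ j) S⁅j⁆)

    ∈R⁻ : ∀ {j} → j ∈ₛ R → S (inj₁ ⁅ j ⁆) ≡ true
    ∈R⁻ {j} j∈R = trans (sym (lookup∘tabulate (λ j → S (inj₁ ⁅ j ⁆)) j)) ([]=⇒lookup j∈R)

    small⊆R⇒∈S : ∀ {Z} → ∣ Z ∣ ≤ℕ 1 → Z ⊆ R → S (inj₁ Z) ≡ true
    small⊆R⇒∈S {Z} ∣Z∣≤1 Z⊆R with ≡∅⊎≡⁅⁆ Z ∣Z∣≤1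
    ... | inj₁ refl       = S∅
    ... | inj₂ (j , refl) = ∈R⁻ (Z⊆R (x∈⁅x⁆ j))

    vertex∈S⇒⊆R : ∀ {Z} → isVertex Z ≡ true → S (inj₁ Z) ≡ true → Z ⊆ R
    vertex∈S⇒⊆R {Z} vertex SZ {j} j∈Z with ≡-dec _≟ᵇ_ Z ⁅ j ⁆
    ... | yes refl   = ∈R⁺ SZ
    ... | no Z≢⁅j⁆ = ∈R⁺ (closed (inj₁ Z) (inj₁ ⁅ j ⁆) SZ arc)
      where
      arc : downArc Z ⁅ j ⁆ ≡ true
      arc = trans (cong₂ (λ p q → p ∧ q ∧ atMostOneᵇ ⁅ j ⁆) vertex (⁅j⁆⊂ᵇZ j∈Z Z≢⁅j⁆)) (atMostOne-⁅⁆ j)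

    jump⇒crossing : ∀ i → (does (X i ⊆? R) ∧ not (does (Y i ⊆? R))) ≡ true → (S (inj₁ (X i)) ∧ not (S (inj₂ i))) ≡ true
    jump⇒crossing i jumps with X i ⊆? R | Y i ⊆? R | S (inj₂ i) in S-mid
    ... | yes X⊆R | no _    | false = cong (_∧ true) (small⊆R⇒∈S (simple i) X⊆R)
    ... | yes _   | no Y⊈R | true  =
      ⊥-elim (Y⊈R (vertex∈S⇒⊆R (isVertex-Y i) (closed (inj₂ i) (inj₁ (Y i)) S-mid (eqᵇ-refl (Y i)))))

    jumpWeight≤cap : jumpWeight F inst δ R ≤ cap capacity S
    jumpWeight≤cap = ≤-trans (sum-mono-≤ constraints λ i → []·-monoˡ-≤ (jump⇒crossing i) (δ≥0 i)) (δ-arcs≤cap S)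

  source≢sink : ∀ t → source ≢ sink t
  source≢sink t source≡sink = ∉⊥ (subst (t ∈ₛ_) (sym (inj₁-injective source≡sink)) (x∈⁅x⁆ t))

  leaksAt : Cut → Node × Node → Bool
  leaksAt S (a , b) = S a ∧ unitArc a b ∧ not (S b)

  leak⇒1≤cap : ∀ S a b → leaksAt S (a , b) ≡ true → 1# ≤ cap capacity S
  leak⇒1≤cap S a b leaks with ∧-true⁻ leaks
  ... | Sa , arc-out with ∧-true⁻ arc-out
  ...   | arc , ¬Sb = subst (_≤ cap capacity S) (unitArc⇒capacity≡1 a b arc)
                            (crossing≤cap capacity-nonneg S Sa (not-injective ¬Sb))

  cutCondition : ∀ t → (∀ R → t ∉ₛ R → 1# ≤ jumpWeight F inst δ R) → CutCondition source (sink t) capacity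
  cutCondition t jumps≥1 S (S∅ , Sₜ) with any? (λ ab → leaksAt S ab ≟ᵇ true) (cartesianProduct nodes nodes)
  ... | yes leak = let (a , b) , _ , leaks = find leak in leak⇒1≤cap S a b leaks
  ... | no no-leak = ≤-trans (jumps≥1 R (λ t∈R → case trans (sym (∈R⁻ t∈R)) Sₜ of λ ())) jumpWeight≤cap
    where
    closed : ∀ a b → S a ≡ true → unitArc a b ≡ true → S b ≡ true
    closed a b Sa arc with S b in Sb
    ... | true  = refl
    ... | false = ⊥-elim (no-leak (lose (∈-cartesianProduct⁺ (∈nodes a) (∈nodes b))
                                         (subst₂ (λ p q → (p ∧ q ∧ not (S b)) ≡ true) (sym Sa) (sym arc) (cong not Sb))))
    open ClosedCut S S∅ closed

  module FromNodeFlow (t : Fin n) (h : Node → Node → Carrier) (h-flow : IsUnitFlowWithin source (sink t) capacity h) where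
    open ≡-Reasoning

    private
      h≥0 : Nonneg h
      h≥0 = proj₁ h-flow
      h≤c : ∀ a b → h a b ≤ capacity a b
      h≤c = proj₁ (proj₂ h-flow)
      conserved : ∀ u → u ≢ source → u ≢ sink t → inAt h u ≡ outAt h u
      conserved = proj₁ (proj₂ (proj₂ h-flow))

    f : Fin k → Carrier
    f i = h (inj₁ (X i)) (inj₂ i)

    g : Subset n → Subset n → Carrier
    g A B = h (inj₁ A) (inj₁ B)

    h-into-constraint : ∀ A i → h (inj₁ A) (inj₂ i) ≡ [ eqᵇ A (X i) ]· h (inj₁ A) (inj₂ i)
    h-into-constraint A i = []·-squeeze (eqᵇ A (X i)) (h≥0 _ _) (h≤c _ _)

    h-from-constraint : ∀ i B → h (inj₂ i) (inj₁ B) ≡ [ eqᵇ B (Y i) ]· h (inj₂ i) (inj₁ B)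
    h-from-constraint i B = []·-squeeze (eqᵇ B (Y i)) (h≥0 _ _) (h≤c _ _)

    h-down : ∀ A B → h (inj₁ A) (inj₁ B) ≡ [ downArc A B ]· h (inj₁ A) (inj₁ B)
    h-down A B = []·-squeeze (downArc A B) (h≥0 _ _) (h≤c _ _)

    h-between-constraints : ∀ i j → h (inj₂ i) (inj₂ j) ≡ 0#
    h-between-constraints i j = antisym (h≤c _ _) (h≥0 _ _)

    through-constraint : ∀ i → h (inj₂ i) (inj₁ (Y i)) ≡ f i
    through-constraint i = begin
      h (inj₂ i) (inj₁ (Y i))
        ≡⟨ select-subset (Y i) (λ B → h (inj₂ i) (inj₁ B)) ⟨
      ∑[ B ∈ subsets ] [ eqᵇ B (Y i) ]· h (inj₂ i) (inj₁ B)
        ≡⟨ sum-cong subsets (λ B → h-from-constraint i B) ⟨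
      ∑[ B ∈ subsets ] h (inj₂ i) (inj₁ B)
        ≡⟨ +-identityʳ _ ⟨
      ∑[ B ∈ subsets ] h (inj₂ i) (inj₁ B) + 0#
        ≡⟨ cong (∑[ B ∈ subsets ] h (inj₂ i) (inj₁ B) +_)
                (trans (sum-cong constraints (h-between-constraints i)) (sum-zero constraints)) ⟨
      ∑[ B ∈ subsets ] h (inj₂ i) (inj₁ B) + ∑[ j ∈ constraints ] h (inj₂ i) (inj₂ j)
        ≡⟨ sum-nodes (h (inj₂ i)) ⟨
      outAt h (inj₂ i)
        ≡⟨ conserved (inj₂ i) (λ ()) (λ ()) ⟨
      inAt h (inj₂ i)
        ≡⟨ sum-nodes (λ a → h a (inj₂ i)) ⟩
      ∑[ A ∈ subsets ] h (inj₁ A) (inj₂ i) + ∑[ j ∈ constraints ] h (inj₂ j) (inj₂ i)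
        ≡⟨ cong₂ _+_ (trans (sum-cong subsets λ A → h-into-constraint A i) (select-subset (X i) (λ A → h (inj₁ A) (inj₂ i))))
                     (trans (sum-cong constraints λ j → h-between-constraints j i) (sum-zero constraints)) ⟩
      f i + 0#
        ≡⟨ +-identityʳ (f i) ⟩
      f i ∎

    inflow≡inAt : ∀ Z → inflow F inst f g Z ≡ inAt h (inj₁ Z)
    inflow≡inAt Z = begin
      inflow F inst f g Z
        ≡⟨ cong₂ _+_ (sumIf≡∑ constraints _ f) (sumIf≡∑ subsets _ _) ⟩
      ∑[ i ∈ constraints ] [ eqᵇ Z (Y i) ]· f i + ∑[ A ∈ subsets ] [ downArc A Z ]· g A Z
        ≡⟨ cong₂ _+_ (sum-cong constraints from-constraint) (sum-cong subsets λ A → sym (h-down A Z)) ⟩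
      ∑[ i ∈ constraints ] h (inj₂ i) (inj₁ Z) + ∑[ A ∈ subsets ] h (inj₁ A) (inj₁ Z)
        ≡⟨ +-comm _ _ ⟩
      ∑[ A ∈ subsets ] h (inj₁ A) (inj₁ Z) + ∑[ i ∈ constraints ] h (inj₂ i) (inj₁ Z)
        ≡⟨ sum-nodes (λ a → h a (inj₁ Z)) ⟨
      inAt h (inj₁ Z) ∎
      where
      from-constraint : ∀ i → [ eqᵇ Z (Y i) ]· f i ≡ h (inj₂ i) (inj₁ Z)
      from-constraint i with eqᵇ Z (Y i) in Z=Y
      ... | true  = trans (sym (through-constraint i)) (cong (λ W → h (inj₂ i) (inj₁ W)) (sym (eqᵇ⇒≡ Z=Y)))
      ... | false = sym (trans (h-from-constraint i Z) (cong ([_]· h (inj₂ i) (inj₁ Z)) Z=Y))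

    outflow≡outAt : ∀ Z → isVertex Z ≡ true → outflow F inst f g Z ≡ outAt h (inj₁ Z)
    outflow≡outAt Z vertex = begin
      outflow F inst f g Z
        ≡⟨ cong₂ _+_ (sumIf≡∑ constraints _ f) (sumIf≡∑ subsets _ _) ⟩
      ∑[ i ∈ constraints ] [ eqᵇ Z (X i) ]· f i + ∑[ B ∈ subsets ] [ isVertex B ∧ ⊂ᵇ B Z ∧ atMostOneᵇ B ]· g Z B
        ≡⟨ cong₂ _+_ (sum-cong constraints into-constraint) (sum-cong subsets down) ⟩
      ∑[ i ∈ constraints ] h (inj₁ Z) (inj₂ i) + ∑[ B ∈ subsets ] h (inj₁ Z) (inj₁ B)
        ≡⟨ +-comm _ _ ⟩
      ∑[ B ∈ subsets ] h (inj₁ Z) (inj₁ B) + ∑[ i ∈ constraints ] h (inj₁ Z) (inj₂ i)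
        ≡⟨ sum-nodes (h (inj₁ Z)) ⟨
      outAt h (inj₁ Z) ∎
      where
      into-constraint : ∀ i → [ eqᵇ Z (X i) ]· f i ≡ h (inj₁ Z) (inj₂ i)
      into-constraint i with eqᵇ Z (X i) in Z=X
      ... | true  = cong (λ W → h (inj₁ W) (inj₂ i)) (sym (eqᵇ⇒≡ Z=X))
      ... | false = sym (trans (h-into-constraint Z i) (cong ([_]· h (inj₁ Z) (inj₂ i)) Z=X))
      -- Arcs of G_δ lead into sets of size ≤ 1, which are vertices; so both guards agree.
      guard≡downArc : ∀ B → (isVertex B ∧ ⊂ᵇ B Z ∧ atMostOneᵇ B) ≡ downArc Z B
      guard≡downArc B with atMostOneᵇ B in small
      ... | true  = trans (cong (λ p → p ∧ ⊂ᵇ B Z ∧ true) (atMostOne⇒isVertex {B} small))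
                          (cong (λ p → p ∧ ⊂ᵇ B Z ∧ true) (sym vertex))
      ... | false = trans (∧∧false (isVertex B) (⊂ᵇ B Z)) (sym (∧∧false (isVertex Z) (⊂ᵇ B Z)))
        where
        ∧∧false : ∀ p q → (p ∧ q ∧ false) ≡ false
        ∧∧false p q = trans (cong (p ∧_) (∧-zeroʳ q)) (∧-zeroʳ p)
      down : ∀ B → [ isVertex B ∧ ⊂ᵇ B Z ∧ atMostOneᵇ B ]· g Z B ≡ h (inj₁ Z) (inj₁ B)
      down B = trans (cong ([_]· g Z B) (guard≡downArc B)) (sym (h-down Z B))

    isUnitFlow : IsUnitFlow F inst δ ⁅ t ⁆ f g
    isUnitFlow = (λ i → h≥0 _ _) , f≤δ , (λ A B → h≥0 _ _) , conservation ,
                 trans (cong₂ _-_ (outflow≡outAt ∅ isVertex-∅) (inflow≡inAt ∅)) (proj₂ (proj₂ (proj₂ h-flow)))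
      where
      f≤δ : ∀ i → f i ≤ δ i
      f≤δ i = subst (f i ≤_) (cong ([_]· δ i) (eqᵇ-refl (X i))) (h≤c (inj₁ (X i)) (inj₂ i))
      conservation : ∀ Z → isVertexᵇ F inst Z ≡ true → Z ≢ ∅ → Z ≢ ⁅ t ⁆ → inflow F inst f g Z ≡ outflow F inst f g Z
      conservation Z vertex Z≢∅ Z≢⁅t⁆ =
        trans (inflow≡inAt Z) (trans (conserved (inj₁ Z) (Z≢∅ ∘ inj₁-injective) (Z≢⁅t⁆ ∘ inj₁-injective))
                                     (sym (outflow≡outAt Z vertex)))

  flowInG : ∀ t → (∀ R → t ∉ₛ R → 1# ≤ jumpWeight F inst δ R) →
            Σ (Fin k → Carrier) λ f → Σ (Subset n → Subset n → Carrier) λ g → IsUnitFlow F inst δ ⁅ t ⁆ f g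
  flowInG t jumps≥1 = f , g , isUnitFlow
    where
    flow : Σ Capacities (IsUnitFlowWithin source (sink t) capacity)
    flow = unitFlow (source≢sink t) capacity capacity-nonneg (cutCondition t jumps≥1)
    open FromNodeFlow t (proj₁ flow) (proj₂ flow)

lemma2 : (F : OrderedField) (n k : ℕ)
         (I : SimpleInstance (OrderedField.Carrier F) n k)
         (δ : Fin k → OrderedField.Carrier F)
       → Σ (Subset n → Subset n → OrderedField.Carrier F) (λ σ →
           Σ (Subset n → Subset n → OrderedField.Carrier F) (λ μ →
             FeasibleD F I δ σ μ))
       → (t : Fin n)
       → Σ (Fin k → OrderedField.Carrier F) (λ f →
           Σ (Subset n → Subset n → OrderedField.Carrier F) (λ g →
             IsUnitFlow F I δ ⁅ t ⁆ f g))
lemma2 F n k I δ (σ , μ , feasible) t =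
  Network.flowInG F I δ (proj₁ feasible) t (λ R t∉R → Uncrossing.jumpWeight≥1 F I δ σ μ feasible R t∉R)
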